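{- For every integer $N\ge 2$, \[ \mathcal{N}_2(N)=\sum_{d\mid N,\ d<N}\big(\mathcal{N}_2(d)+2\mathcal{N}_1(d)\big)=2d_2(N)-4+\sum_{d\mid N,\ d<N}\mathcal{N}_2(d), \] and, with $\mathcal{M}_k=\mathcal{N}_k/k!$, \[ \mathcal{M}_2(N)=\sum_{d\mid N,\ d<N}\big(\mathcal{M}_2(d)+\mathcal{M}_1(d)\big)=c_2(N)+\sum_{d\mid N,\ d<N}\mathcal{M}_2(d). \]
   Context: For $k\in\mathbb{N}$, $\mathcal{N}_k(n)$ is the number of ordered $k$-tuples of sets $A_1,\dots,A_k\subset\mathbb{N}_0$ with $|A_j|\ge 2$, $|A_1|\cdots|A_k|=n$ and $A_1+\dots+A_k=\{0,1,\dots,n-1\}$ (Minkowski sum); in particular $\mathcal{N}_1(1)=0$ and $\mathcal{N}_1(d)=1$ for $d>1$. $d_2(N)$ is the number of divisors of $N$ (ordered factorisations $N=n_1n_2$ with $n_1,n_2\ge1$), and $c_2(N)=d_2(N)-2$ is the number of ordered factorisations $N=n_1n_2$ with $n_1,n_2\ge 2$. -}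

module Defs where

open import Data.Bool using (Bool; true; false; _∧_; not)
open import Data.Nat using (ℕ; zero; suc; _+_; _*_; _∸_; _<ᵇ_; _≡ᵇ_; _!)
open import Data.Nat.Properties using (_!≢0)
open import Data.Nat.Divisibility using (_∣?_)
open import Data.List using (List; []; _∷_; [_]; _++_; map; concatMap; length; upTo; filter; filterᵇ; foldr)
open import Data.Bool.ListAction using (all; any)
open import Data.Nat.ListAction using (product)
open import Data.Integer using () renaming (+_ to ℤ+)
open import Data.Rational using (ℚ; 0ℚ) renaming (_+_ to _+ℚ_; _/_ to _/ℚ_)

-- Finite subsets of a finite set of naturals given as a strictly increasing
-- list: all sublists (each subset exactly once when the input has no repeats).
subsets : List ℕ → List (List ℕ)
subsets []       = [ [] ]
subsets (x ∷ xs) = subsets xs ++ map (x ∷_) (subsets xs)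

tuples : ℕ → {A : Set} → List A → List (List A)
tuples zero    xs = [ [] ]
tuples (suc k) xs = concatMap (λ a → map (a ∷_) (tuples k xs)) xs

sumset : List (List ℕ) → List ℕ
sumset []       = [ 0 ]
sumset (A ∷ As) = concatMap (λ a → map (λ s → a + s) (sumset As)) A

memb : ℕ → List ℕ → Bool
memb m xs = any (m ≡ᵇ_) xs

sumsetIsInterval : ℕ → List (List ℕ) → Bool
sumsetIsInterval n As =
  all (λ m → memb m (sumset As)) (upTo n) ∧ all (_<ᵇ n) (sumset As)

valid : ℕ → List (List ℕ) → Bool
valid n As =
  all (λ A → 1 <ᵇ length A) As ∧ (product (map length As) ≡ᵇ n) ∧ sumsetIsInterval n As

-- 𝒩_k(n): number of ordered k-tuples (A₁,…,A_k) of sets A_j ⊂ ℕ₀ with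
-- |A_j| ≥ 2, |A₁|⋯|A_k| = n and A₁+⋯+A_k = {0,…,n-1}.
-- Any such A_j is automatically a subset of {0,…,n-1} (the minima sum to 0,
-- so every A_j contains 0, hence A_j ⊆ A₁+⋯+A_k), so enumerating k-tuples of
-- subsets of {0,…,n-1} counts all of them.
𝒩 : ℕ → ℕ → ℕ
𝒩 k n = length (filterᵇ (valid n) (tuples k (subsets (upTo n))))

ℳ : ℕ → ℕ → ℚ
ℳ k n = (ℤ+ (𝒩 k n)) /ℚ (k !) where instance _ = k !≢0

-- proper divisors d ∣ N, d < N (d ranges over 0,…,N-1; 0 ∤ N for N ≥ 1)
properDivisors : ℕ → List ℕ
properDivisors N = filter (_∣? N) (upTo N)

d₂ : ℕ → ℕ
d₂ N = length (filter (_∣? N) (upTo (suc N)))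

c₂ : ℕ → ℕ
c₂ N = d₂ N ∸ 2

sumℕ : List ℕ → ℕ
sumℕ = foldr _+_ 0

sumℚ : List ℚ → ℚ
sumℚ = foldr _+ℚ_ 0ℚ

-- In a two-factor tiling A ⊕ B = {0, …, N-1} exactly one factor contains 1, so 𝒩₂(N) is twice
-- the number of normal tilings, those with 1 ∈ A. Let m be the least positive element of B.
-- Then [0, m) ⊆ A, and by strong induction on k every block [k m, k m + m) is contained in A
-- or disjoint from it, while B meets it at most in k m. Hence m divides N = d m, and
-- A = m Y ⊕ [0, m), B = m X for a tiling X ⊕ Y = {0, …, d-1} with 1 ∈ X. Conversely every
-- such (d, X, Y) lifts, and d, X, Y are recovered from the lift. The quotient is either the
-- trivial tiling ([0, d), {0}), counted by 𝒩₁(d) = 1, or again a normal tiling with |Y| ≥ 2,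
-- so 𝒩₂(N) / 2 = Σ (1 + 𝒩₂(d) / 2) over the divisors 1 < d < N. The divisor d = 1 contributes
-- nothing since 𝒩₁(1) = 𝒩₂(1) = 0; the remaining identities are arithmetic.

module Submission where

open import Data.Nat using (ℕ; zero; suc; _+_; _*_; _≤_; _<_; z≤n; s≤s; z<s; _≟_; _≡ᵇ_; _<ᵇ_; pred; >-nonZero; >-nonZero⁻¹; _∸_; _<?_; NonZero; _/_; _%_; _≤?_)
open import Data.Nat.Properties
open import Data.Nat.DivMod using (m≡m%n+[m/n]*n; m%n<n; m<n*o⇒m/o<n; m*n/n≡m; m/n*n≡m)
open import Data.Nat.Divisibility using (_∣_; divides; _∣?_; ∣-antisym; 0∣⇒≡0; 1∣_; ∣-refl)
open import Data.Nat.Induction using (<-rec)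
open import Data.Nat.ListAction using (sum; product)
open import Data.Nat.Tactic.RingSolver using (solve-∀)
open import Algebra.Properties.CommutativeSemigroup +-commutativeSemigroup using (xy∙z≈xz∙y; x∙yz≈y∙xz; interchange)
open import Data.Integer using () renaming (+_ to ℤ+; _*_ to _*ℤ_; _+_ to _+ℤ_)
open import Data.Integer.Properties using (pos-+)
open import Data.Integer.Tactic.RingSolver using () renaming (solve-∀ to solveℤ-∀)
open import Data.Rational using (ℚ) renaming (_+_ to _+ℚ_; _/_ to _/ℚ_)
open import Data.Rational.Properties using (toℚᵘ-injective; toℚᵘ-homo-+; toℚᵘ-fromℚᵘ; 0/n≡0)
open import Data.Rational.Unnormalised using (mkℚᵘ; *≡*)
open import Data.Rational.Unnormalised.Properties using (≃-trans; ≃-sym; +-cong)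
open import Data.Bool using (T)
open import Data.Bool.Properties using (T-∧)
open import Data.Bool.ListAction using (all)
open import Data.List using (List; []; _∷_; _++_; map; concatMap; length; filter; [_]; upTo; filterᵇ; applyUpTo)
open import Data.List.Properties using (length-++; length-++-sucʳ; ∷-injectiveˡ; ∷-injectiveʳ; length-map; length-upTo; ∷-injective; map-cong; filter-accept; filter-reject; filter-all; filter-++; upTo-∷ʳ; map-cong-local)
open import Data.List.Extrema.Nat using (min; min≤xs; argmin-all)
open import Data.List.Membership.Propositional using (_∈_; _∉_; find)
open import Data.List.Membership.Propositional.Properties using (∈-∃++; ∈-concatMap⁺; ∈-filter⁺; ∈-filter⁻; ∈-map⁻; ∈-++⁺ˡ; ∈-++⁺ʳ; ∈-++⁻; ∈-concatMap⁻; ∈-map⁺; ∈-upTo⁺; ∈-upTo⁻; ∈-applyUpTo⁻)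
open import Data.List.Membership.Propositional.Properties.WithK using (unique∧set⇒bag)
open import Data.List.Membership.DecPropositional _≟_ using (_∈?_)
open import Data.List.Relation.Binary.BagAndSetEquality using (∼bag⇒↭)
open import Data.List.Relation.Binary.Permutation.Propositional.Properties using (↭-length)
open import Data.List.Relation.Binary.Subset.Propositional using (_⊆_)
open import Data.List.Relation.Binary.Sublist.Propositional as Sublist using ([]; _∷_; _∷ʳ_; ⊆-refl) renaming (_⊆_ to _⊑_)
open import Data.List.Relation.Binary.Sublist.Propositional.Properties using (filter-⊆; length-mono-≤)
open import Data.List.Relation.Unary.Any as Any using (here; there)
open import Data.List.Relation.Unary.Any.Properties using (any⁺; any⁻)
open import Data.List.Relation.Unary.All as All using (All; []; _∷_)
open import Data.List.Relation.Unary.All.Properties using (¬Any⇒All¬; anti-mono; all⁺; all⁻)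
open import Data.List.Relation.Unary.AllPairs using ([]; _∷_)
open import Data.List.Relation.Unary.Unique.Propositional using (Unique)
open import Data.List.Relation.Unary.Unique.Propositional.Properties using (filter⁺; ++⁺; map⁺; upTo⁺)
open import Data.Empty using (⊥; ⊥-elim)
open import Data.Product using (∃; _×_; _,_; ∃₂; proj₁; proj₂)
open import Data.Sum using (inj₁; inj₂; _⊎_)
open import Function using (mk⇔; _∘_; _⇔_; Equivalence; _∘′_)
open import Relation.Binary.Definitions using (DecidableEquality)
open import Relation.Binary.PropositionalEquality using (_≡_; _≢_; refl; sym; trans; cong; cong₂; subst; module ≡-Reasoning; subst₂)
open import Relation.Nullary using (¬_; ¬?; Dec; yes; no; contradiction)
open import Relation.Nullary.Decidable using (T?)
open import Defs

private variable
  A B : Set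
  xs ys zs : List A
  k : ℕ

unique∧⊆⇒length≤ : Unique xs → xs ⊆ ys → length xs ≤ length ys
unique∧⊆⇒length≤ {xs = []} _ _ = z≤n
unique∧⊆⇒length≤ {xs = x ∷ xs} (x∉xs ∷ u) x∷xs⊆ys with ys₁ , ys₂ , refl ← ∈-∃++ (x∷xs⊆ys (here refl)) =
  ≤-trans (s≤s (unique∧⊆⇒length≤ u xs⊆ys₁++ys₂)) (≤-reflexive (sym (length-++-sucʳ ys₁ x ys₂)))
  where
  xs⊆ys₁++ys₂ : xs ⊆ ys₁ ++ ys₂
  xs⊆ys₁++ys₂ {z} z∈xs with ∈-++⁻ ys₁ (x∷xs⊆ys (there z∈xs))
  ... | inj₁ z∈ys₁ = ∈-++⁺ˡ z∈ys₁
  ... | inj₂ (here refl) = contradiction refl (All.lookup x∉xs z∈xs)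
  ... | inj₂ (there z∈ys₂) = ∈-++⁺ʳ ys₁ z∈ys₂

unique∧⊆⊇⇒length≡ : Unique xs → Unique ys → xs ⊆ ys → ys ⊆ xs → length xs ≡ length ys
unique∧⊆⊇⇒length≡ ux uy xs⊆ys ys⊆xs = ↭-length (∼bag⇒↭ (unique∧set⇒bag ux uy (mk⇔ xs⊆ys ys⊆xs)))

distinct-∈⇒1<length : ∀ {x y} → x ∈ xs → y ∈ xs → x ≢ y → 1 < length xs
distinct-∈⇒1<length x∈ y∈ x≢y =
  unique∧⊆⇒length≤ ((x≢y ∷ []) ∷ [] ∷ []) λ { (here refl) → x∈ ; (there (here refl)) → y∈ }

module _ {A : Set} (_≟_ : DecidableEquality A) where

  ⊇∧length≤⇒unique : {zs ys : List A} → Unique zs → zs ⊆ ys → length ys ≤ length zs → Unique ys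
  ⊇∧length≤⇒unique {ys = []} _ _ _ = []
  ⊇∧length≤⇒unique {zs = zs} {ys = y ∷ ys} uzs zs⊆y∷ys |y∷ys|≤|zs| =
    ¬Any⇒All¬ ys y∉ys ∷ ⊇∧length≤⇒unique (filter⁺ ≢y? uzs) zs∖y⊆ys |ys|≤|zs∖y|
    where
    ≢y? : ∀ z → Dec (z ≢ y)
    ≢y? z = ¬? (z ≟ y)

    zs∖y : List A
    zs∖y = filter ≢y? zs

    zs∖y⊆ys : zs∖y ⊆ ys
    zs∖y⊆ys z∈ with z∈zs , z≢y ← ∈-filter⁻ ≢y? z∈ with zs⊆y∷ys z∈zs
    ... | here z≡y = contradiction z≡y z≢y
    ... | there z∈ys = z∈ys

    zs⊆y∷zs∖y : zs ⊆ y ∷ zs∖y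
    zs⊆y∷zs∖y {z} z∈zs with z ≟ y
    ... | yes refl = here refl
    ... | no z≢y = there (∈-filter⁺ ≢y? z∈zs z≢y)

    |ys|≤|zs∖y| : length ys ≤ length zs∖y
    |ys|≤|zs∖y| = ≤-pred (≤-trans |y∷ys|≤|zs| (unique∧⊆⇒length≤ uzs zs⊆y∷zs∖y))

    y∉ys : y ∉ ys
    y∉ys y∈ys = <-irrefl refl (≤-trans |y∷ys|≤|zs| (unique∧⊆⇒length≤ uzs zs⊆ys))
      where
      zs⊆ys : zs ⊆ ys
      zs⊆ys z∈zs with zs⊆y∷ys z∈zs
      ... | here refl = y∈ys
      ... | there z∈ys = z∈ys

⊑-extensional : Unique zs → xs ⊑ zs → ys ⊑ zs → xs ⊆ ys → ys ⊆ xs → xs ≡ ys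
⊑-extensional _ [] [] _ _ = refl
⊑-extensional (_ ∷ u) (z ∷ʳ p) (.z ∷ʳ q) xs⊆ys ys⊆xs = ⊑-extensional u p q xs⊆ys ys⊆xs
⊑-extensional (z∉ ∷ _) (_ ∷ʳ p) (refl ∷ _) _ ys⊆xs =
  contradiction refl (All.lookup z∉ (Sublist.lookup p (ys⊆xs (here refl))))
⊑-extensional (z∉ ∷ _) (refl ∷ _) (_ ∷ʳ q) xs⊆ys _ =
  contradiction refl (All.lookup z∉ (Sublist.lookup q (xs⊆ys (here refl))))
⊑-extensional {zs = z ∷ zs} (z∉ ∷ u) (refl ∷ p) (refl ∷ q) xs⊆ys ys⊆xs =
  cong (z ∷_) (⊑-extensional u p q (drop-head p xs⊆ys) (drop-head q ys⊆xs))
  where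
  drop-head : ∀ {us vs} → us ⊑ zs → z ∷ us ⊆ z ∷ vs → us ⊆ vs
  drop-head p us⊆vs w∈us with us⊆vs (there w∈us)
  ... | here refl = contradiction refl (All.lookup z∉ (Sublist.lookup p w∈us))
  ... | there w∈vs = w∈vs

⊑-unique : xs ⊑ ys → Unique ys → Unique xs
⊑-unique [] _ = []
⊑-unique (_ ∷ʳ p) (_ ∷ u) = ⊑-unique p u
⊑-unique (refl ∷ p) (y∉ ∷ u) = anti-mono (Sublist.lookup p) y∉ ∷ ⊑-unique p u

map-unique : (f : A → B) → (∀ {x y} → x ∈ xs → y ∈ xs → f x ≡ f y → x ≡ y) →
             Unique xs → Unique (map f xs)
map-unique f _ [] = []
map-unique {xs = x ∷ xs} f f-inj (x∉xs ∷ u) =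
  All.tabulate fx∉ ∷ map-unique f (λ p q → f-inj (there p) (there q)) u
  where
  fx∉ : ∀ {v} → v ∈ map f xs → f x ≢ v
  fx∉ v∈ fx≡v with y , y∈xs , refl ← ∈-map⁻ f v∈ =
    All.lookup x∉xs y∈xs (f-inj (here refl) (there y∈xs) fx≡v)

++-unique⁻ʳ : ∀ (us : List A) {vs} → Unique (us ++ vs) → Unique vs
++-unique⁻ʳ [] u = u
++-unique⁻ʳ (_ ∷ us) (_ ∷ u) = ++-unique⁻ʳ us u

++-unique-disjoint : ∀ (us : List A) {vs z} → Unique (us ++ vs) → z ∈ us → z ∉ vs
++-unique-disjoint (_ ∷ us) (u∉ ∷ _) (here refl) z∈vs = contradiction refl (All.lookup u∉ (∈-++⁺ʳ us z∈vs))
++-unique-disjoint (_ ∷ us) (_ ∷ u) (there z∈us) z∈vs = ++-unique-disjoint us u z∈us z∈vs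

concatMap-unique : (g : A → List B) → Unique xs → (∀ {x} → x ∈ xs → Unique (g x)) →
                   (∀ {x x′ z} → x ∈ xs → x′ ∈ xs → z ∈ g x → z ∈ g x′ → x ≡ x′) →
                   Unique (concatMap g xs)
concatMap-unique g [] _ _ = []
concatMap-unique {xs = x ∷ xs} g (x∉xs ∷ u) ug g-disj =
  ++⁺ (ug (here refl)) (concatMap-unique g u (ug ∘ there) (λ p q → g-disj (there p) (there q))) disjoint
  where
  disjoint : ∀ {z} → ¬ (z ∈ g x × z ∈ concatMap g xs)
  disjoint (z∈gx , z∈gxs) with x′ , x′∈xs , z∈gx′ ← find (∈-concatMap⁻ g z∈gxs) =
    All.lookup x∉xs x′∈xs (g-disj (here refl) (there x′∈xs) z∈gx z∈gx′)

concatMap-unique⁻ : (g : A → List B) → Unique (concatMap g xs) →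
                    ∀ {x x′ z} → x ∈ xs → x′ ∈ xs → z ∈ g x → z ∈ g x′ → x ≡ x′
concatMap-unique⁻ g u (here refl) (here refl) _ _ = refl
concatMap-unique⁻ {xs = x ∷ xs} g u (here refl) (there x′∈) z∈gx z∈gx′ =
  contradiction (∈-concatMap⁺ g (Any.map (λ { refl → z∈gx′ }) x′∈)) (++-unique-disjoint (g x) u z∈gx)
concatMap-unique⁻ {xs = x ∷ xs} g u (there x∈) (here refl) z∈gx z∈gx′ =
  contradiction (∈-concatMap⁺ g (Any.map (λ { refl → z∈gx }) x∈)) (++-unique-disjoint (g x) u z∈gx′)
concatMap-unique⁻ {xs = x ∷ xs} g u (there x∈) (there x′∈) =
  concatMap-unique⁻ g (++-unique⁻ʳ (g x) u) x∈ x′∈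

length-concatMap : (g : A → List B) (xs : List A) → length (concatMap g xs) ≡ sum (map (length ∘ g) xs)
length-concatMap g [] = refl
length-concatMap g (x ∷ xs) = trans (length-++ (g x)) (cong (length (g x) +_) (length-concatMap g xs))

∈-subsets⁻ : {xs ys : List ℕ} → ys ∈ subsets xs → ys ⊑ xs
∈-subsets⁻ {[]} (here refl) = []
∈-subsets⁻ {x ∷ xs} ys∈ with ∈-++⁻ (subsets xs) ys∈
... | inj₁ ys∈′ = x ∷ʳ ∈-subsets⁻ ys∈′
... | inj₂ x∷zs∈ with zs , zs∈ , refl ← ∈-map⁻ (x ∷_) x∷zs∈ = refl ∷ ∈-subsets⁻ zs∈

∈-subsets⁺ : {xs ys : List ℕ} → ys ⊑ xs → ys ∈ subsets xs
∈-subsets⁺ [] = here refl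
∈-subsets⁺ (x ∷ʳ ys⊑xs) = ∈-++⁺ˡ (∈-subsets⁺ ys⊑xs)
∈-subsets⁺ {x ∷ xs} (refl ∷ ys⊑xs) = ∈-++⁺ʳ (subsets xs) (∈-map⁺ (x ∷_) (∈-subsets⁺ ys⊑xs))

subsets-unique : {xs : List ℕ} → Unique xs → Unique (subsets xs)
subsets-unique {[]} _ = [] ∷ []
subsets-unique {x ∷ xs} (x∉xs ∷ u) =
  ++⁺ (subsets-unique u) (map⁺ ∷-injectiveʳ (subsets-unique u)) disjoint
  where
  disjoint : ∀ {ys} → ¬ (ys ∈ subsets xs × ys ∈ map (x ∷_) (subsets xs))
  disjoint (ys∈ , x∷zs∈) with zs , _ , refl ← ∈-map⁻ (x ∷_) x∷zs∈ =
    contradiction refl (All.lookup x∉xs (Sublist.lookup (∈-subsets⁻ ys∈) (here refl)))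

∈-tuples⁻ : ∀ {ys} → ys ∈ tuples (suc k) xs → ∃₂ λ a as → ys ≡ a ∷ as × a ∈ xs × as ∈ tuples k xs
∈-tuples⁻ {k = k} {xs = xs} ys∈
  with a , a∈xs , ys∈′ ← find (∈-concatMap⁻ (λ a → map (a ∷_) (tuples k xs)) {xs = xs} ys∈)
  with as , as∈ , refl ← ∈-map⁻ (a ∷_) ys∈′ = a , as , refl , a∈xs , as∈

∈-tuples⁺ : ∀ {k} {xs : List A} {a as} → a ∈ xs → as ∈ tuples k xs → a ∷ as ∈ tuples (suc k) xs
∈-tuples⁺ {k = k} {xs} {a} a∈xs as∈ =
  ∈-concatMap⁺ (λ a → map (a ∷_) (tuples k xs)) (Any.map (λ { refl → ∈-map⁺ (a ∷_) as∈ }) a∈xs)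

tuples-unique : ∀ k → Unique xs → Unique (tuples k xs)
tuples-unique zero _ = [] ∷ []
tuples-unique {xs = xs} (suc k) u =
  concatMap-unique (λ a → map (a ∷_) (tuples k xs)) u (λ _ → map⁺ ∷-injectiveʳ (tuples-unique k u)) same-head
  where
  same-head : ∀ {a a′ ys} → a ∈ xs → a′ ∈ xs → ys ∈ map (a ∷_) (tuples k xs) → ys ∈ map (a′ ∷_) (tuples k xs) → a ≡ a′
  same-head _ _ p q with _ , _ , refl ← ∈-map⁻ _ p with _ , _ , eq ← ∈-map⁻ _ q = ∷-injectiveˡ eq

-- Sumsets and tilings

infixl 6 _⊕_

opaque
  _⊕_ : List ℕ → List ℕ → List ℕ
  A ⊕ B = concatMap (λ a → map (a +_) B) A

module _ {A B : List ℕ} where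
  opaque
    unfolding _⊕_

    ∈-⊕⁺ : ∀ {a b} → a ∈ A → b ∈ B → a + b ∈ A ⊕ B
    ∈-⊕⁺ {a} a∈A b∈B = ∈-concatMap⁺ (λ a → map (a +_) B) (Any.map (λ { refl → ∈-map⁺ (a +_) b∈B }) a∈A)

    ∈-⊕⁻ : ∀ {t} → t ∈ A ⊕ B → ∃₂ λ a b → a ∈ A × b ∈ B × a + b ≡ t
    ∈-⊕⁻ t∈ with a , a∈A , t∈′ ← find (∈-concatMap⁻ (λ a → map (a +_) B) {xs = A} t∈)
            with b , b∈B , refl ← ∈-map⁻ (a +_) t∈′ = a , b , a∈A , b∈B , refl

    ⊕-unique⁻ : Unique (A ⊕ B) → ∀ {a b a′ b′} → a ∈ A → b ∈ B → a′ ∈ A → b′ ∈ B → a + b ≡ a′ + b′ → a ≡ a′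
    ⊕-unique⁻ u {a′ = a′} a∈ b∈ a′∈ b′∈ eq =
      concatMap-unique⁻ (λ a → map (a +_) B) u a∈ a′∈ (∈-map⁺ _ b∈)
        (subst (_∈ map (a′ +_) B) (sym eq) (∈-map⁺ (a′ +_) b′∈))

    ⊕-unique : Unique A → Unique B →
               (∀ {a b a′ b′} → a ∈ A → b ∈ B → a′ ∈ A → b′ ∈ B → a + b ≡ a′ + b′ → a ≡ a′) →
               Unique (A ⊕ B)
    ⊕-unique uA uB sum-inj = concatMap-unique (λ a → map (a +_) B) uA (λ {a} _ → map⁺ (+-cancelˡ-≡ a _ _) uB) same-a
      where
      same-a : ∀ {a a′ t} → a ∈ A → a′ ∈ A → t ∈ map (a +_) B → t ∈ map (a′ +_) B → a ≡ a′
      same-a a∈ a′∈ t∈ t∈′ with b , b∈ , refl ← ∈-map⁻ _ t∈ with b′ , b′∈ , eq ← ∈-map⁻ _ t∈′ =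
        sum-inj a∈ b∈ a′∈ b′∈ eq

opaque
  unfolding _⊕_

  length-⊕ : ∀ A B → length (A ⊕ B) ≡ length A * length B
  length-⊕ [] B = refl
  length-⊕ (a ∷ A) B = trans (length-++ (map (a +_) B)) (cong₂ _+_ (length-map (a +_) B) (length-⊕ A B))

record Tiling (N : ℕ) (A B : List ℕ) : Set where
  field
    sum-< : ∀ {a b} → a ∈ A → b ∈ B → a + b < N
    sum-onto : ∀ {t} → t < N → ∃₂ λ a b → a ∈ A × b ∈ B × a + b ≡ t
    sum-unique : ∀ {a b a′ b′} → a ∈ A → b ∈ B → a′ ∈ A → b′ ∈ B → a + b ≡ a′ + b′ → a ≡ a′

  sum-uniqueʳ : ∀ {a b a′ b′} → a ∈ A → b ∈ B → a′ ∈ A → b′ ∈ B → a + b ≡ a′ + b′ → b ≡ b′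
  sum-uniqueʳ a∈A b∈B a′∈A b′∈B eq with refl ← sum-unique a∈A b∈B a′∈A b′∈B eq = +-cancelˡ-≡ _ _ _ eq

  0∈ˡ : 0 < N → 0 ∈ A
  0∈ˡ 0<N with a , b , a∈A , _ , a+b≡0 ← sum-onto 0<N = subst (_∈ A) (m+n≡0⇒m≡0 a a+b≡0) a∈A

  0∈ʳ : 0 < N → 0 ∈ B
  0∈ʳ 0<N with a , b , _ , b∈B , a+b≡0 ← sum-onto 0<N = subst (_∈ B) (m+n≡0⇒m≡0 b (trans (+-comm b a) a+b≡0)) b∈B

  ∈ˡ∩ʳ⇒≡0 : ∀ {x} → x ∈ A → x ∈ B → x ≡ 0
  ∈ˡ∩ʳ⇒≡0 x∈A x∈B = sum-unique x∈A (0∈ʳ 0<N) (0∈ˡ 0<N) x∈B (+-identityʳ _)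
    where 0<N = ≤-trans (s≤s z≤n) (sum-< x∈A x∈B)

  swap : Tiling N B A
  swap = record
    { sum-< = λ {b} {a} b∈B a∈A → subst (_< N) (+-comm a b) (sum-< a∈A b∈B)
    ; sum-onto = λ t<N → let a , b , a∈A , b∈B , a+b≡t = sum-onto t<N in b , a , b∈B , a∈A , trans (+-comm b a) a+b≡t
    ; sum-unique = λ {b} {a} {b′} {a′} b∈B a∈A b′∈B a′∈A b+a≡b′+a′ →
        sum-uniqueʳ a∈A b∈B a′∈A b′∈B (trans (+-comm a b) (trans b+a≡b′+a′ (+-comm b′ a′)))
    }

  1∈ˡ⊎1∈ʳ : 1 < N → 1 ∈ A ⊎ 1 ∈ B
  1∈ˡ⊎1∈ʳ 1<N with sum-onto 1<N
  ... | 0 , _ , _ , 1∈B , refl = inj₂ 1∈B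
  ... | 1 , 0 , 1∈A , _ , refl = inj₁ 1∈A

  1∉ˡ∩ʳ : 1 ∈ A → 1 ∈ B → ⊥
  1∉ˡ∩ʳ 1∈A 1∈B with () ← ∈ˡ∩ʳ⇒≡0 1∈A 1∈B

-- Exactly one factor of a tiling contains 1; a normal tiling puts it first and lists both
-- factors in increasing order, as `subsets (upTo N)` does.
record NormalTiling (N : ℕ) (A B : List ℕ) : Set where
  field
    A⊑ : A ⊑ upTo N
    B⊑ : B ⊑ upTo N
    tiling : Tiling N A B
    1∈A : 1 ∈ A

  1<N : 1 < N
  1<N = ∈-upTo⁻ (Sublist.lookup A⊑ 1∈A)

  1<|A| : 1 < length A
  1<|A| = distinct-∈⇒1<length (Tiling.0∈ˡ tiling (<-trans z<s 1<N)) 1∈A (λ ())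

opaque
  canonical : ℕ → List ℕ → List ℕ
  canonical N S = filter (_∈? S) (upTo N)

module _ {N : ℕ} {S : List ℕ} where
  opaque
    unfolding canonical

    ∈-canonical⁺ : ∀ {x} → x < N → x ∈ S → x ∈ canonical N S
    ∈-canonical⁺ x<N = ∈-filter⁺ (_∈? S) (∈-upTo⁺ x<N)

    ∈-canonical⁻ : ∀ {x} → x ∈ canonical N S → x < N × x ∈ S
    ∈-canonical⁻ x∈ with x∈upTo , x∈S ← ∈-filter⁻ (_∈? S) {xs = upTo N} x∈ = ∈-upTo⁻ x∈upTo , x∈S

    canonical-⊑ : canonical N S ⊑ upTo N
    canonical-⊑ = filter-⊆ (_∈? S) (upTo N)

IsInterval : ℕ → List ℕ → Set
IsInterval N S = (∀ {t} → t < N → t ∈ S) × (∀ {s} → s ∈ S → s < N)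

tiling⇔ : ∀ {N A B} → Unique A → Unique B → Tiling N A B ⇔ (length A * length B ≡ N × IsInterval N (A ⊕ B))
tiling⇔ {N} {A} {B} uA uB = mk⇔ to from
  where
  to : Tiling N A B → length A * length B ≡ N × IsInterval N (A ⊕ B)
  to tiling = trans (sym (length-⊕ A B)) (trans |A⊕B|≡|upTo| (length-upTo N)) , covers , bounded
    where
    open Tiling tiling
    covers : ∀ {t} → t < N → t ∈ A ⊕ B
    covers t<N with _ , _ , a∈A , b∈B , refl ← sum-onto t<N = ∈-⊕⁺ a∈A b∈B
    bounded : ∀ {s} → s ∈ A ⊕ B → s < N
    bounded s∈ with _ , _ , a∈A , b∈B , refl ← ∈-⊕⁻ s∈ = sum-< a∈A b∈B
    |A⊕B|≡|upTo| : length (A ⊕ B) ≡ length (upTo N)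
    |A⊕B|≡|upTo| = unique∧⊆⊇⇒length≡ (⊕-unique uA uB sum-unique) (upTo⁺ N)
                     (∈-upTo⁺ ∘′ bounded) (covers ∘′ ∈-upTo⁻)
  from : length A * length B ≡ N × IsInterval N (A ⊕ B) → Tiling N A B
  from (|A|*|B|≡N , covers , bounded) = record
    { sum-< = λ a∈A b∈B → bounded (∈-⊕⁺ a∈A b∈B)
    ; sum-onto = λ t<N → ∈-⊕⁻ (covers t<N)
    ; sum-unique = ⊕-unique⁻ A⊕B-unique
    }
    where
    A⊕B-unique : Unique (A ⊕ B)
    A⊕B-unique = ⊇∧length≤⇒unique _≟_ (upTo⁺ N) (covers ∘′ ∈-upTo⁻)
                   (≤-reflexive (trans (length-⊕ A B) (trans |A|*|B|≡N (sym (length-upTo N)))))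

T-all⇔ : ∀ {A : Set} {p} {xs : List A} → T (all p xs) ⇔ All (T ∘′ p) xs
T-all⇔ {p = p} {xs} = mk⇔ (all⁺ p xs) (all⁻ p)

T-memb⇔ : ∀ {m xs} → T (memb m xs) ⇔ m ∈ xs
T-memb⇔ {m} {xs} = mk⇔ (λ t → Any.map (≡ᵇ⇒≡ m _) (any⁻ (m ≡ᵇ_) xs t))
                       (λ m∈ → any⁺ (m ≡ᵇ_) (Any.map (≡⇒≡ᵇ m _) m∈))

T-sumsetIsInterval⇔ : ∀ {n As} → T (sumsetIsInterval n As) ⇔ IsInterval n (sumset As)
T-sumsetIsInterval⇔ {n} {As} = mk⇔ to from
  where
  to : T (sumsetIsInterval n As) → IsInterval n (sumset As)
  to t = (λ t<n → Equivalence.to T-memb⇔ (All.lookup (Equivalence.to T-all⇔ covers) (∈-upTo⁺ t<n)))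
       , (λ s∈ → <ᵇ⇒< _ n (All.lookup (Equivalence.to T-all⇔ bounded) s∈))
    where
    covers : T (all (λ m → memb m (sumset As)) (upTo n))
    covers = proj₁ (Equivalence.to T-∧ t)
    bounded : T (all (_<ᵇ n) (sumset As))
    bounded = proj₂ (Equivalence.to (T-∧ {all (λ m → memb m (sumset As)) (upTo n)}) t)
  from : IsInterval n (sumset As) → T (sumsetIsInterval n As)
  from (covers , bounded) = Equivalence.from T-∧
    ( Equivalence.from (T-all⇔ {xs = upTo n}) (All.tabulate λ t∈ → Equivalence.from T-memb⇔ (covers (∈-upTo⁻ t∈)))
    , Equivalence.from (T-all⇔ {xs = sumset As}) (All.tabulate λ s∈ → <⇒<ᵇ (bounded s∈)))

T-valid⇔ : ∀ {n As} → T (valid n As) ⇔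
           (All (λ A → 1 < length A) As × product (map length As) ≡ n × IsInterval n (sumset As))
T-valid⇔ {n} {As} = mk⇔ to from
  where
  to : T (valid n As) → All (λ A → 1 < length A) As × product (map length As) ≡ n × IsInterval n (sumset As)
  to t = let sizes , rest = Equivalence.to T-∧ t
             size , interval = Equivalence.to T-∧ rest
         in All.map (<ᵇ⇒< 1 _) (Equivalence.to T-all⇔ sizes) , ≡ᵇ⇒≡ _ n size , Equivalence.to (T-sumsetIsInterval⇔ {n} {As}) interval
  from : All (λ A → 1 < length A) As × product (map length As) ≡ n × IsInterval n (sumset As) → T (valid n As)
  from (sizes , size , interval) = Equivalence.from T-∧
    ( Equivalence.from (T-all⇔ {xs = As}) (All.map <⇒<ᵇ sizes)
    , Equivalence.from T-∧ (≡⇒≡ᵇ _ n size , Equivalence.from (T-sumsetIsInterval⇔ {n} {As}) interval))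

sumset-[_] : ∀ B → sumset [ B ] ≡ B
sumset-[ [] ] = refl
sumset-[ b ∷ B ] = cong₂ _∷_ (+-identityʳ b) sumset-[ B ]

opaque
  unfolding _⊕_

  sumset-pair : ∀ A B → sumset (A ∷ B ∷ []) ≡ A ⊕ B
  sumset-pair A B = cong (λ S → Data.List.concatMap (λ a → map (a +_) S) A) sumset-[ B ]

valid-pair⇔ : ∀ {N A B} → A ⊑ upTo N → B ⊑ upTo N →
              T (valid N (A ∷ B ∷ [])) ⇔ (Tiling N A B × 1 < length A × 1 < length B)
valid-pair⇔ {N} {A} {B} A⊑ B⊑ = mk⇔ to from
  where
  tiling⇔′ : Tiling N A B ⇔ (length A * length B ≡ N × IsInterval N (A ⊕ B))
  tiling⇔′ = tiling⇔ (⊑-unique A⊑ (upTo⁺ N)) (⊑-unique B⊑ (upTo⁺ N))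
  |B|*1≡|B| : length B * 1 ≡ length B
  |B|*1≡|B| = *-identityʳ (length B)
  to : T (valid N (A ∷ B ∷ [])) → Tiling N A B × 1 < length A × 1 < length B
  to t with 1<|A| ∷ 1<|B| ∷ [] , size , interval ← Equivalence.to (T-valid⇔ {N} {A ∷ B ∷ []}) t =
    Equivalence.from tiling⇔′ (trans (cong (length A *_) (sym |B|*1≡|B|)) size , subst (IsInterval N) (sumset-pair A B) interval)
    , 1<|A| , 1<|B|
  from : Tiling N A B × 1 < length A × 1 < length B → T (valid N (A ∷ B ∷ []))
  from (tiling , 1<|A| , 1<|B|) with size , interval ← Equivalence.to tiling⇔′ tiling =
    Equivalence.from (T-valid⇔ {N} {A ∷ B ∷ []})
      (1<|A| ∷ 1<|B| ∷ [] , trans (cong (length A *_) |B|*1≡|B|) size , subst (IsInterval N) (sym (sumset-pair A B)) interval)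

valid-singleton⇔ : ∀ {d A} → 2 ≤ d → A ⊑ upTo d → T (valid d [ A ]) ⇔ A ≡ upTo d
valid-singleton⇔ {d} {A} 2≤d A⊑ = mk⇔ to from
  where
  to : T (valid d [ A ]) → A ≡ upTo d
  to t with _ , _ , covers , _ ← Equivalence.to (T-valid⇔ {d} {[ A ]}) t =
    ⊑-extensional (upTo⁺ d) A⊑ ⊆-refl (Sublist.lookup A⊑) (λ t∈ → subst (_ ∈_) sumset-[ A ] (covers (∈-upTo⁻ t∈)))
  from : A ≡ upTo d → T (valid d [ A ])
  from refl = Equivalence.from (T-valid⇔ {d} {[ upTo d ]})
    ( subst (1 <_) (sym (length-upTo d)) 2≤d ∷ []
    , trans (*-identityʳ _) (length-upTo d)
    , (λ t<d → subst (_ ∈_) (sym sumset-[ upTo d ]) (∈-upTo⁺ t<d))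
    , (λ s∈ → ∈-upTo⁻ (subst (_ ∈_) sumset-[ upTo d ] s∈)))

-- Block structure of a normal tiling

divMod-unique : ∀ {m q q′ r r′} → r < m → r′ < m → q * m + r ≡ q′ * m + r′ → q ≡ q′ × r ≡ r′
divMod-unique {q = zero} {zero} _ _ eq = refl , eq
divMod-unique {m} {zero} {suc q′} {r} {r′} r<m _ eq =
  contradiction (subst (_< m) eq r<m) (≤⇒≯ (subst (m ≤_) (sym (+-assoc m (q′ * m) r′)) (m≤m+n m _)))
divMod-unique {m} {suc q} {zero} {r} _ r′<m eq =
  contradiction (subst (_< m) (sym eq) r′<m) (≤⇒≯ (subst (m ≤_) (sym (+-assoc m (q * m) r)) (m≤m+n m _)))
divMod-unique {m} {suc q} {suc q′} {r} {r′} r<m r′<m eq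
  with q≡q′ , r≡r′ ← divMod-unique r<m r′<m (+-cancelˡ-≡ m _ _ (trans (sym (+-assoc m _ r)) (trans eq (+-assoc m _ r′))))
  = cong suc q≡q′ , r≡r′

[qm+r]+jm≡[q+j]m+r : ∀ q j m r → (q * m + r) + j * m ≡ (q + j) * m + r
[qm+r]+jm≡[q+j]m+r = solve-∀

module _ (m : ℕ) .{{_ : NonZero m}} where

  quotRem : ∀ x → x ≡ x / m * m + x % m
  quotRem x = trans (m≡m%n+[m/n]*n x m) (+-comm (x % m) _)

  quotRem-of-sum : ∀ {a j k i} → i < m → a + j * m ≡ k * m + i → a / m + j ≡ k × a % m ≡ i
  quotRem-of-sum {a} {j} {k} {i} i<m eq = divMod-unique (m%n<n a m) i<m (begin
    (a / m + j) * m + a % m   ≡⟨ [qm+r]+jm≡[q+j]m+r (a / m) j m (a % m) ⟨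
    (a / m * m + a % m) + j * m ≡⟨ cong (_+ j * m) (sym (quotRem a)) ⟩
    a + j * m                 ≡⟨ eq ⟩
    k * m + i                 ∎)
    where open ≡-Reasoning

module Blocks {N : ℕ} {A B : List ℕ} (tiling : Tiling N A B) (1∈A : 1 ∈ A)
              {m : ℕ} .{{_ : NonZero m}} (m∈B : m ∈ B) (m-least : ∀ {b} → 0 < b → b < m → b ∉ B) where

  open Tiling tiling

  0<N : 0 < N
  0<N = ≤-trans (s≤s z≤n) (sum-< 1∈A m∈B)

  0∈A : 0 ∈ A
  0∈A = 0∈ˡ 0<N

  0∈B : 0 ∈ B
  0∈B = 0∈ʳ 0<N

  B-bounded : ∀ {b} → b ∈ B → b < N
  B-bounded = sum-< 0∈A

  A-bounded : ∀ {a} → a ∈ A → a < N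
  A-bounded {a} a∈A = subst (_< N) (+-identityʳ a) (sum-< a∈A 0∈B)

  1<m : 1 < m
  1<m = ≤∧≢⇒< (>-nonZero⁻¹ m) (λ 1≡m → 1∉ˡ∩ʳ 1∈A (subst (_∈ B) (sym 1≡m) m∈B))

  below-m-⊆A : ∀ {i} → i < m → i ∈ A
  below-m-⊆A i<m with a , b , a∈A , b∈B , a+b≡i ← sum-onto (<-trans i<m (B-bounded m∈B)) with b ≟ 0
  ... | yes refl = subst (_∈ A) (trans (sym (+-identityʳ a)) a+b≡i) a∈A
  ... | no b≢0 = contradiction b∈B (m-least (n≢0⇒n>0 b≢0) (≤-<-trans (subst (_ ≤_) a+b≡i (m≤n+m b a)) i<m))

  record BlockClosed (k : ℕ) : Set where
    field
      A-base : ∀ {i} → i < m → k * m + i ∈ A → k * m ∈ A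
      A-fill : k * m ∈ A → ∀ {i} → i < m → k * m + i ∈ A
      B-gap  : ∀ {i} → 0 < i → i < m → k * m + i ∉ B

  first-block : BlockClosed 0
  first-block = record { A-base = λ _ _ → 0∈A ; A-fill = λ _ → below-m-⊆A ; B-gap = m-least }

  block-beyond : ∀ {k} → N ≤ k * m → BlockClosed k
  block-beyond {k} N≤km = record
    { A-base = λ _ km+i∈A → contradiction (A-bounded km+i∈A) (≤⇒≯ (≤-trans N≤km (m≤m+n _ _)))
    ; A-fill = λ km∈A → contradiction (A-bounded km∈A) (≤⇒≯ N≤km)
    ; B-gap = λ _ _ km+i∈B → contradiction (B-bounded km+i∈B) (≤⇒≯ (≤-trans N≤km (m≤m+n _ _)))
    }

  multiple-of-closed : ∀ {b} → b ∈ B → BlockClosed (b / m) → b ≡ b / m * m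
  multiple-of-closed {b} b∈B closed with b % m ≟ 0
  ... | yes r≡0 = trans (quotRem m b) (trans (cong (b / m * m +_) r≡0) (+-identityʳ _))
  ... | no r≢0 = contradiction (subst (_∈ B) (quotRem m b) b∈B) (BlockClosed.B-gap closed (n≢0⇒n>0 r≢0) (m%n<n b m))

  base-of-closed : ∀ {a} → a ∈ A → BlockClosed (a / m) → a / m * m ∈ A
  base-of-closed {a} a∈A closed = BlockClosed.A-base closed (m%n<n a m) (subst (_∈ A) (quotRem m a) a∈A)

  module Step {k : ℕ} (0<k : 0 < k) (ih : ∀ {j} → j < k → BlockClosed j) where

    km≢0 : k * m ≢ 0
    km≢0 = m<n⇒n≢0 (*-monoˡ-< m 0<k)

    multiple-below : ∀ {b} → b ∈ B → b < k * m → b ≡ b / m * m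
    multiple-below b∈B b<km = multiple-of-closed b∈B (ih (m<n*o⇒m/o<n b<km))

    -- If k m + i = a + b with 0 < b < k m, then b = j m and a lies in block q = k - j, which is
    -- full; the sums (q m + i′) + b = k m + i′ keep A out of block k and B out of its interior.
    module Split {a b i} (a∈A : a ∈ A) (b∈B : b ∈ B) (0<b : 0 < b) (b<km : b < k * m)
                 (i<m : i < m) (a+b≡km+i : a + b ≡ k * m + i) where

      j q : ℕ
      j = b / m
      q = a / m

      b≡jm : b ≡ j * m
      b≡jm = multiple-below b∈B b<km

      j≢0 : j ≢ 0
      j≢0 j≡0 = <⇒≢ 0<b (sym (trans b≡jm (cong (_* m) j≡0)))

      q+j≡k×a%m≡i : q + j ≡ k × a % m ≡ i
      q+j≡k×a%m≡i = quotRem-of-sum m i<m (trans (cong (a +_) (sym b≡jm)) a+b≡km+i)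

      q+j≡k : q + j ≡ k
      q+j≡k = proj₁ q+j≡k×a%m≡i

      q<k : q < k
      q<k = subst (q <_) q+j≡k (m<m+n q (n≢0⇒n>0 j≢0))

      block-q : ∀ {i′} → i′ < m → q * m + i′ ∈ A
      block-q = BlockClosed.A-fill (ih q<k) (base-of-closed a∈A (ih q<k))

      shift : ∀ i′ → (q * m + i′) + b ≡ k * m + i′
      shift i′ = begin
        (q * m + i′) + b     ≡⟨ cong ((q * m + i′) +_) b≡jm ⟩
        (q * m + i′) + j * m ≡⟨ xy∙z≈xz∙y (q * m) i′ (j * m) ⟩
        (q * m + j * m) + i′ ≡⟨ cong (_+ i′) (sym (*-distribʳ-+ m q j)) ⟩
        (q + j) * m + i′     ≡⟨ cong (λ x → x * m + i′) q+j≡k ⟩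
        k * m + i′           ∎
        where open ≡-Reasoning

      no-A : ∀ {i′} → i′ < m → k * m + i′ ∉ A
      no-A {i′} i′<m km+i′∈A = j≢0 (+-cancelˡ-≡ q j 0 (trans q+j≡k (trans k≡q (sym (+-identityʳ q)))))
        where
        k≡q : k ≡ q
        k≡q = *-cancelʳ-≡ k q m (+-cancelʳ-≡ i′ _ _
                (sum-unique km+i′∈A 0∈B (block-q i′<m) b∈B (trans (+-identityʳ _) (sym (shift i′)))))

      no-B : ∀ {i′} → 0 < i′ → i′ < m → k * m + i′ ∉ B
      no-B {i′} 0<i′ i′<m km+i′∈B =
        <⇒≢ 0<i′ (sym (m+n≡0⇒n≡0 (q * m) (sum-unique (block-q i′<m) b∈B 0∈A km+i′∈B (shift i′))))

    km∈B⇒closed : k * m ∈ B → BlockClosed k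
    km∈B⇒closed km∈B = record
      { A-base = λ {i} i<m km+i∈A → ⊥-elim (km≢0 (+-cancelʳ-≡ i (k * m) 0
          (sum-unique km+i∈A 0∈B (below-m-⊆A i<m) km∈B (trans (+-identityʳ _) (+-comm (k * m) i)))))
      ; A-fill = λ km∈A → ⊥-elim (km≢0 (∈ˡ∩ʳ⇒≡0 km∈A km∈B))
      ; B-gap = λ {i} 0<i i<m km+i∈B → <⇒≢ 0<i (sym (sum-unique (below-m-⊆A i<m) km∈B 0∈A km+i∈B (+-comm i (k * m))))
      }

    split⇒closed : ∀ {a b} → a ∈ A → b ∈ B → 0 < b → b < k * m → a + b ≡ k * m → BlockClosed k
    split⇒closed a∈A b∈B 0<b b<km a+b≡km = record
      { A-base = λ i<m km+i∈A → ⊥-elim (no-A i<m km+i∈A)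
      ; A-fill = λ km∈A → ⊥-elim (no-A 0<m (subst (_∈ A) (sym (+-identityʳ _)) km∈A))
      ; B-gap = no-B
      }
      where
      0<m : 0 < m
      0<m = >-nonZero⁻¹ m
      open Split a∈A b∈B 0<b b<km 0<m (trans a+b≡km (sym (+-identityʳ _)))

    km∈A⇒closed : k * m ∈ A → BlockClosed k
    km∈A⇒closed km∈A = record { A-base = λ _ _ → km∈A ; A-fill = λ _ → fill ; B-gap = gap }
      where
      gap : ∀ {i} → 0 < i → i < m → k * m + i ∉ B
      gap {i} 0<i i<m km+i∈B = <⇒≢ (<-≤-trans m∸i<m m≤km)
        (sum-unique (below-m-⊆A m∸i<m) km+i∈B km∈A m∈B (begin
          (m ∸ i) + (k * m + i) ≡⟨ x∙yz≈y∙xz (m ∸ i) (k * m) i ⟩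
          k * m + ((m ∸ i) + i) ≡⟨ cong (k * m +_) (m∸n+n≡m (<⇒≤ i<m)) ⟩
          k * m + m             ∎))
        where
        open ≡-Reasoning
        m∸i<m : m ∸ i < m
        m∸i<m = ∸-monoʳ-< 0<i (<⇒≤ i<m)
        m≤km : m ≤ k * m
        m≤km = m≤n*m m k {{>-nonZero 0<k}}

      B-avoids : ∀ {b} → b ∈ B → k * m ≤ b → b < k * m + m → ⊥
      B-avoids {b} b∈B km≤b b<km+m with b ∸ k * m | m+[n∸m]≡n km≤b
      ... | zero | km+0≡b = km≢0 (∈ˡ∩ʳ⇒≡0 km∈A (subst (_∈ B) (trans (sym km+0≡b) (+-identityʳ _)) b∈B))
      ... | suc i | km+i≡b = gap z<s (+-cancelˡ-< (k * m) _ m (subst (_< k * m + m) (sym km+i≡b) b<km+m))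
                                 (subst (_∈ B) (sym km+i≡b) b∈B)

      fill : ∀ {i} → i < m → k * m + i ∈ A
      fill {i} i<m with a , b , a∈A , b∈B , a+b≡km+i ← sum-onto (<-trans (+-monoʳ-< (k * m) i<m) (sum-< km∈A m∈B))
        with b ≟ 0 | b <? k * m
      ... | yes refl | _ = subst (_∈ A) (trans (sym (+-identityʳ a)) a+b≡km+i) a∈A
      ... | no b≢0 | yes b<km = ⊥-elim (Split.no-A a∈A b∈B (n≢0⇒n>0 b≢0) b<km i<m a+b≡km+i (>-nonZero⁻¹ m)
                                          (subst (_∈ A) (sym (+-identityʳ _)) km∈A))
      ... | no _ | no b≮km = ⊥-elim (B-avoids b∈B (≮⇒≥ b≮km)
                                      (≤-<-trans (subst (b ≤_) a+b≡km+i (m≤n+m b a)) (+-monoʳ-< (k * m) i<m)))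

  -- Strong induction on k, by the shape of the decomposition k m = a + b:
  -- b = k m, 0 < b < k m, or b = 0 (that is, k m ∈ A).
  all-blocks-closed : ∀ k → BlockClosed k
  all-blocks-closed = <-rec BlockClosed step
    where
    step : ∀ k → (∀ {j} → j < k → BlockClosed j) → BlockClosed k
    step zero _ = first-block
    step k@(suc _) ih with k * m <? N
    ... | no km≮N = block-beyond (≮⇒≥ km≮N)
    ... | yes km<N with a , b , a∈A , b∈B , a+b≡km ← sum-onto km<N with b ≟ k * m | b ≟ 0
    ...   | yes refl | _ = Step.km∈B⇒closed z<s ih b∈B
    ...   | no _ | yes refl = Step.km∈A⇒closed z<s ih (subst (_∈ A) (trans (sym (+-identityʳ a)) a+b≡km) a∈A)
    ...   | no b≢km | no b≢0 =
      Step.split⇒closed z<s ih a∈A b∈B (n≢0⇒n>0 b≢0) (≤∧≢⇒< (subst (b ≤_) a+b≡km (m≤n+m b a)) b≢km) a+b≡km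

  B-multiple : ∀ {b} → b ∈ B → b ≡ b / m * m
  B-multiple b∈B = multiple-of-closed b∈B (all-blocks-closed _)

  A-base : ∀ {a} → a ∈ A → a / m * m ∈ A
  A-base a∈A = base-of-closed a∈A (all-blocks-closed _)

  A-fill : ∀ {q r} → q * m ∈ A → r < m → q * m + r ∈ A
  A-fill {q} qm∈A = BlockClosed.A-fill (all-blocks-closed q) qm∈A

  N≡1+[N-1] : N ≡ suc (pred N)
  N≡1+[N-1] = sym (suc-pred N {{>-nonZero 0<N}})

  N-1<N : pred N < N
  N-1<N = ≤-reflexive (sym N≡1+[N-1])

  -- N - 1 = a + b forces a to end its block: otherwise a + 1 ∈ A and (a + 1) + b = N.
  N-multiple : ∃ λ d → N ≡ d * m
  N-multiple with a , b , a∈A , b∈B , a+b≡N-1 ← sum-onto N-1<N = suc (a / m + b / m) , (begin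
    N                                     ≡⟨ trans N≡1+[N-1] (cong suc (sym a+b≡N-1)) ⟩
    suc (a + b)                           ≡⟨ cong₂ (λ x y → suc (x + y)) (quotRem m a) (B-multiple b∈B) ⟩
    suc ((a / m * m + a % m) + b / m * m) ≡⟨ cong suc ([qm+r]+jm≡[q+j]m+r (a / m) (b / m) m (a % m)) ⟩
    suc ((a / m + b / m) * m + a % m)     ≡⟨ +-suc _ (a % m) ⟨
    (a / m + b / m) * m + suc (a % m)     ≡⟨ cong ((a / m + b / m) * m +_) suc[a%m]≡m ⟩
    (a / m + b / m) * m + m               ≡⟨ +-comm _ m ⟩
    suc (a / m + b / m) * m               ∎)
    where
    open ≡-Reasoning
    suc[a%m]≡m : suc (a % m) ≡ m
    suc[a%m]≡m with suc (a % m) <? m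
    ... | no a%m+1≮m = ≤-antisym (m%n<n a m) (≮⇒≥ a%m+1≮m)
    ... | yes a%m+1<m = contradiction (sum-< (A-fill {a / m} (A-base a∈A) a%m+1<m) b∈B) (≤⇒≯ (≤-reflexive (begin
      N                             ≡⟨ trans N≡1+[N-1] (cong suc (sym a+b≡N-1)) ⟩
      suc (a + b)                   ≡⟨ cong (λ x → suc (x + b)) (quotRem m a) ⟩
      suc (a / m * m + a % m) + b   ≡⟨ cong (_+ b) (sym (+-suc (a / m * m) (a % m))) ⟩
      (a / m * m + suc (a % m)) + b ∎)))

-- Lifting a tiling by a factor m

opaque
  liftˡ : ℕ → ℕ → List ℕ → List ℕ
  liftˡ m N Y = canonical N (map (_* m) Y ⊕ upTo m)

  liftʳ : ℕ → ℕ → List ℕ → List ℕ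
  liftʳ m N X = canonical N (map (_* m) X)

lift : ℕ → ℕ → List (List ℕ) → List (List ℕ)
lift m N (X ∷ Y ∷ []) = liftˡ m N Y ∷ liftʳ m N X ∷ []
lift m N _ = []  -- not a pair: junk value, never used

module _ {m N : ℕ} where
  opaque
    unfolding liftˡ liftʳ

    ∈-liftˡ⁺ : ∀ {Y y r} → y * m + r < N → y ∈ Y → r < m → y * m + r ∈ liftˡ m N Y
    ∈-liftˡ⁺ bound y∈Y r<m = ∈-canonical⁺ bound (∈-⊕⁺ (∈-map⁺ (_* m) y∈Y) (∈-upTo⁺ r<m))

    ∈-liftˡ⁻ : ∀ {Y x} → x ∈ liftˡ m N Y → x < N × ∃₂ λ y r → y ∈ Y × r < m × y * m + r ≡ x
    ∈-liftˡ⁻ x∈ with x<N , x∈⊕ ← ∈-canonical⁻ x∈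
      with ym , r , ym∈ , r∈ , refl ← ∈-⊕⁻ x∈⊕
      with y , y∈Y , refl ← ∈-map⁻ (_* m) ym∈ = x<N , y , r , y∈Y , ∈-upTo⁻ r∈ , refl

    ∈-liftʳ⁺ : ∀ {X x} → x * m < N → x ∈ X → x * m ∈ liftʳ m N X
    ∈-liftʳ⁺ bound x∈X = ∈-canonical⁺ bound (∈-map⁺ (_* m) x∈X)

    ∈-liftʳ⁻ : ∀ {X b} → b ∈ liftʳ m N X → b < N × ∃ λ x → x ∈ X × x * m ≡ b
    ∈-liftʳ⁻ b∈ with b<N , b∈map ← ∈-canonical⁻ b∈
      with x , x∈X , refl ← ∈-map⁻ (_* m) b∈map = b<N , x , x∈X , refl

    liftˡ-⊑ : ∀ {Y} → liftˡ m N Y ⊑ upTo N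
    liftˡ-⊑ = canonical-⊑

    liftʳ-⊑ : ∀ {X} → liftʳ m N X ⊑ upTo N
    liftʳ-⊑ = canonical-⊑

  liftʳ-multiple : ∀ {X b} → b ∈ liftʳ m N X → m ∣ b
  liftʳ-multiple b∈ with _ , x , _ , refl ← ∈-liftʳ⁻ b∈ = divides x refl

  module _ .{{_ : NonZero m}} where

    liftˡ-scaled⁺ : ∀ {Y y} → y * m < N → y ∈ Y → y * m ∈ liftˡ m N Y
    liftˡ-scaled⁺ {Y} {y} ym<N y∈Y =
      subst (_∈ liftˡ m N Y) (+-identityʳ (y * m))
        (∈-liftˡ⁺ (subst (_< N) (sym (+-identityʳ (y * m))) ym<N) y∈Y (>-nonZero⁻¹ m))

    liftˡ-scaled⁻ : ∀ {Y y} → y * m ∈ liftˡ m N Y → y ∈ Y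
    liftˡ-scaled⁻ {y = y} ym∈ with _ , y′ , r , y′∈Y , r<m , eq ← ∈-liftˡ⁻ ym∈ =
      subst (_∈ _) (proj₁ (divMod-unique r<m (>-nonZero⁻¹ m) (trans eq (sym (+-identityʳ (y * m)))))) y′∈Y

    liftʳ-scaled⁻ : ∀ {X x} → x * m ∈ liftʳ m N X → x ∈ X
    liftʳ-scaled⁻ {x = x} xm∈ with _ , x′ , x′∈X , eq ← ∈-liftʳ⁻ xm∈ = subst (_∈ _) (*-cancelʳ-≡ x′ x m eq) x′∈X

module _ {d m N : ℕ} .{{_ : NonZero m}} (N≡d*m : N ≡ d * m) where

  scaled-< : ∀ {y r} → y < d → r < m → y * m + r < N
  scaled-< {y} {r} y<d r<m = begin-strict
    y * m + r   <⟨ +-monoʳ-< (y * m) r<m ⟩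
    y * m + m   ≡⟨ +-comm (y * m) m ⟩
    suc y * m   ≤⟨ *-monoˡ-≤ m y<d ⟩
    d * m       ≡⟨ N≡d*m ⟨
    N           ∎
    where open ≤-Reasoning

  liftˡ-injective : ∀ {Y Y′} → Y ⊑ upTo d → Y′ ⊑ upTo d → liftˡ m N Y ≡ liftˡ m N Y′ → Y ≡ Y′
  liftˡ-injective {Y} {Y′} Y⊑ Y′⊑ eq = ⊑-extensional (upTo⁺ d) Y⊑ Y′⊑ (transport Y⊑ eq) (transport Y′⊑ (sym eq))
    where
    transport : ∀ {Z Z′} → Z ⊑ upTo d → liftˡ m N Z ≡ liftˡ m N Z′ → ∀ {y} → y ∈ Z → y ∈ Z′
    transport Z⊑ eq′ {y} y∈Z = liftˡ-scaled⁻ (subst (y * m ∈_) eq′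
      (liftˡ-scaled⁺ (subst (_< N) (+-identityʳ (y * m)) (scaled-< (∈-upTo⁻ (Sublist.lookup Z⊑ y∈Z)) (>-nonZero⁻¹ m))) y∈Z))

  liftʳ-injective : ∀ {X X′} → X ⊑ upTo d → X′ ⊑ upTo d → liftʳ m N X ≡ liftʳ m N X′ → X ≡ X′
  liftʳ-injective {X} {X′} X⊑ X′⊑ eq = ⊑-extensional (upTo⁺ d) X⊑ X′⊑ (transport X⊑ eq) (transport X′⊑ (sym eq))
    where
    transport : ∀ {Z Z′} → Z ⊑ upTo d → liftʳ m N Z ≡ liftʳ m N Z′ → ∀ {x} → x ∈ Z → x ∈ Z′
    transport Z⊑ eq′ {x} x∈Z = liftʳ-scaled⁻ (subst (x * m ∈_) eq′
      (∈-liftʳ⁺ (subst (_< N) (+-identityʳ (x * m)) (scaled-< (∈-upTo⁻ (Sublist.lookup Z⊑ x∈Z)) (>-nonZero⁻¹ m))) x∈Z))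

module Lifting {d m N : ℕ} (1<m : 1 < m) (N≡d*m : N ≡ d * m) {X Y : List ℕ} (normal : NormalTiling d X Y) where

  private instance
    m-nonZero : NonZero m
    m-nonZero = >-nonZero (<-trans z<s 1<m)

  open NormalTiling normal using () renaming (A⊑ to X⊑; 1∈A to 1∈X)
  open Tiling (NormalTiling.tiling normal)

  A↑ B↑ : List ℕ
  A↑ = liftˡ m N Y
  B↑ = liftʳ m N X

  X-bounded : ∀ {x} → x ∈ X → x < d
  X-bounded x∈X = ∈-upTo⁻ (Sublist.lookup X⊑ x∈X)

  regroup : ∀ x y r → (y * m + r) + x * m ≡ (x + y) * m + r
  regroup x y r = trans ([qm+r]+jm≡[q+j]m+r y x m r) (cong (λ s → s * m + r) (+-comm y x))

  lifted-tiling : Tiling N A↑ B↑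
  lifted-tiling = record { sum-< = bounded ; sum-onto = onto ; sum-unique = unique }
    where
    bounded : ∀ {a b} → a ∈ A↑ → b ∈ B↑ → a + b < N
    bounded a∈A↑ b∈B↑ with _ , y , r , y∈Y , r<m , refl ← ∈-liftˡ⁻ a∈A↑ | _ , x , x∈X , refl ← ∈-liftʳ⁻ b∈B↑ =
      subst (_< N) (sym (regroup x y r)) (scaled-< N≡d*m (sum-< x∈X y∈Y) r<m)

    onto : ∀ {t} → t < N → ∃₂ λ a b → a ∈ A↑ × b ∈ B↑ × a + b ≡ t
    onto {t} t<N with x , y , x∈X , y∈Y , x+y≡t/m ← sum-onto (m<n*o⇒m/o<n (subst (t <_) N≡d*m t<N)) =
      y * m + t % m , x * m ,
      ∈-liftˡ⁺ (≤-<-trans (m≤m+n _ _) sum<N) y∈Y (m%n<n t m) ,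
      ∈-liftʳ⁺ (≤-<-trans (m≤n+m _ _) sum<N) x∈X ,
      sum≡t
      where
      sum≡t : (y * m + t % m) + x * m ≡ t
      sum≡t = trans (regroup x y (t % m)) (trans (cong (λ q → q * m + t % m) x+y≡t/m) (sym (quotRem m t)))
      sum<N : (y * m + t % m) + x * m < N
      sum<N = subst (_< N) (sym sum≡t) t<N

    unique : ∀ {a b a′ b′} → a ∈ A↑ → b ∈ B↑ → a′ ∈ A↑ → b′ ∈ B↑ → a + b ≡ a′ + b′ → a ≡ a′
    unique a∈A↑ b∈B↑ a′∈A↑ b′∈B↑ eq
      with _ , y , r , y∈Y , r<m , refl ← ∈-liftˡ⁻ a∈A↑ | _ , x , x∈X , refl ← ∈-liftʳ⁻ b∈B↑
         | _ , y′ , r′ , y′∈Y , r′<m , refl ← ∈-liftˡ⁻ a′∈A↑ | _ , x′ , x′∈X , refl ← ∈-liftʳ⁻ b′∈B↑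
      with x+y≡x′+y′ , refl ← divMod-unique r<m r′<m (trans (sym (regroup x y r)) (trans eq (regroup x′ y′ r′)))
      with refl ← sum-unique x∈X y∈Y x′∈X y′∈Y x+y≡x′+y′
      with refl ← +-cancelˡ-≡ x y y′ x+y≡x′+y′ = refl

  0<d : 0 < d
  0<d = <-trans z<s (X-bounded 1∈X)

  1∈A↑ : 1 ∈ A↑
  1∈A↑ = ∈-liftˡ⁺ (scaled-< N≡d*m 0<d 1<m) (0∈ʳ 0<d) 1<m

  scaledʳ : ∀ {x} → x ∈ X → x * m ∈ B↑
  scaledʳ {x} x∈X = ∈-liftʳ⁺ (subst (_< N) (+-identityʳ (x * m)) (scaled-< N≡d*m (X-bounded x∈X) (>-nonZero⁻¹ m))) x∈X

  m∈B↑ : m ∈ B↑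
  m∈B↑ = subst (_∈ B↑) (*-identityˡ m) (scaledʳ 1∈X)

  1<|B↑| : 1 < length B↑
  1<|B↑| = distinct-∈⇒1<length (scaledʳ (0∈ˡ 0<d)) m∈B↑ (<⇒≢ (<-trans z<s 1<m))

  lifted : NormalTiling N A↑ B↑
  lifted = record { A⊑ = liftˡ-⊑ ; B⊑ = liftʳ-⊑ ; tiling = lifted-tiling ; 1∈A = 1∈A↑ }

-- Descent to the quotient tiling

positive-∈ : ∀ {B} → Unique B → 1 < length B → ∃ λ b → b ∈ B × 0 < b
positive-∈ {_ ∷ []} _ (s≤s ())
positive-∈ {b₁ ∷ b₂ ∷ _} ((b₁≢b₂ ∷ _) ∷ _) _ with b₁ ≟ 0
... | yes refl = b₂ , there (here refl) , n≢0⇒n>0 (b₁≢b₂ ∘ sym)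
... | no b₁≢0 = b₁ , here refl , n≢0⇒n>0 b₁≢0

least-positive : ∀ {N B} → B ⊑ upTo N → 1 < length B →
                 ∃ λ m → m ∈ B × 0 < m × (∀ {b} → 0 < b → b < m → b ∉ B)
least-positive {N} {B} B⊑ 1<|B| with b , b∈B , 0<b ← positive-∈ (⊑-unique B⊑ (upTo⁺ N)) 1<|B| =
  min b positives , proj₁ m∈B×0<m , proj₂ m∈B×0<m , m-least
  where
  positives : List ℕ
  positives = filter (0 <?_) B
  m∈B×0<m : min b positives ∈ B × 0 < min b positives
  m∈B×0<m = argmin-all (λ x → x) {P = λ x → x ∈ B × 0 < x} (b∈B , 0<b) (All.tabulate (∈-filter⁻ (0 <?_) {xs = B}))
  m-least : ∀ {b′} → 0 < b′ → b′ < min b positives → b′ ∉ B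
  m-least 0<b′ b′<m b′∈B = <⇒≱ b′<m (All.lookup (min≤xs b positives) (∈-filter⁺ (0 <?_) b′∈B 0<b′))

module Descent {N : ℕ} {A B : List ℕ} (normal : NormalTiling N A B)
               {m : ℕ} (m∈B : m ∈ B) (0<m : 0 < m) (m-least : ∀ {b} → 0 < b → b < m → b ∉ B) where

  open NormalTiling normal
  open Tiling tiling

  instance
    m-nonZero : NonZero m
    m-nonZero = >-nonZero 0<m

  open Blocks tiling 1∈A m∈B m-least public using (1<m; A-bounded; B-bounded; B-multiple; A-base; A-fill; N-multiple)

  d : ℕ
  d = proj₁ N-multiple

  N≡d*m : N ≡ d * m
  N≡d*m = proj₂ N-multiple

  X : List ℕ
  X = filter (λ x → x * m ∈? B) (upTo d)

  Y : List ℕ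
  Y = filter (λ y → y * m ∈? A) (upTo d)

  scaled-<N⇒<d : ∀ {x} → x * m < N → x < d
  scaled-<N⇒<d {x} xm<N = *-cancelʳ-< m x d (subst (x * m <_) N≡d*m xm<N)

  ∈X⁺ : ∀ {x} → x * m ∈ B → x ∈ X
  ∈X⁺ xm∈B = ∈-filter⁺ (λ x → x * m ∈? B) (∈-upTo⁺ (scaled-<N⇒<d (B-bounded xm∈B))) xm∈B

  ∈X⁻ : ∀ {x} → x ∈ X → x * m ∈ B
  ∈X⁻ x∈X = proj₂ (∈-filter⁻ (λ x → x * m ∈? B) {xs = upTo d} x∈X)

  ∈Y⁺ : ∀ {y} → y * m ∈ A → y ∈ Y
  ∈Y⁺ ym∈A = ∈-filter⁺ (λ y → y * m ∈? A) (∈-upTo⁺ (scaled-<N⇒<d (A-bounded ym∈A))) ym∈A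

  ∈Y⁻ : ∀ {y} → y ∈ Y → y * m ∈ A
  ∈Y⁻ y∈Y = proj₂ (∈-filter⁻ (λ y → y * m ∈? A) {xs = upTo d} y∈Y)

  quotient-tiling : Tiling d X Y
  quotient-tiling = record { sum-< = bounded ; sum-onto = onto ; sum-unique = unique }
    where
    scaled-sum : ∀ x y → (x + y) * m ≡ y * m + x * m
    scaled-sum x y = trans (*-distribʳ-+ m x y) (+-comm (x * m) (y * m))

    bounded : ∀ {x y} → x ∈ X → y ∈ Y → x + y < d
    bounded {x} {y} x∈X y∈Y = scaled-<N⇒<d (subst (_< N) (sym (scaled-sum x y)) (sum-< (∈Y⁻ y∈Y) (∈X⁻ x∈X)))

    onto : ∀ {t} → t < d → ∃₂ λ x y → x ∈ X × y ∈ Y × x + y ≡ t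
    onto {t} t<d with a , b , a∈A , b∈B , a+b≡tm ← sum-onto (subst (t * m <_) (sym N≡d*m) (*-monoˡ-< m t<d))
      with q+j≡t , _ ← quotRem-of-sum m (>-nonZero⁻¹ m)
                         (trans (cong (a +_) (sym (B-multiple b∈B))) (trans a+b≡tm (sym (+-identityʳ _)))) =
      b / m , a / m , ∈X⁺ (subst (_∈ B) (B-multiple b∈B) b∈B) , ∈Y⁺ (A-base a∈A) , trans (+-comm (b / m) (a / m)) q+j≡t

    unique : ∀ {x y x′ y′} → x ∈ X → y ∈ Y → x′ ∈ X → y′ ∈ Y → x + y ≡ x′ + y′ → x ≡ x′
    unique {x} {y} {x′} {y′} x∈X y∈Y x′∈X y′∈Y eq = *-cancelʳ-≡ x x′ m
      (sum-uniqueʳ (∈Y⁻ y∈Y) (∈X⁻ x∈X) (∈Y⁻ y′∈Y) (∈X⁻ x′∈X)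
        (trans (sym (scaled-sum x y)) (trans (cong (_* m) eq) (scaled-sum x′ y′))))

  quotient : NormalTiling d X Y
  quotient = record
    { A⊑ = filter-⊆ (λ x → x * m ∈? B) (upTo d)
    ; B⊑ = filter-⊆ (λ y → y * m ∈? A) (upTo d)
    ; tiling = quotient-tiling
    ; 1∈A = ∈X⁺ (subst (_∈ B) (sym (*-identityˡ m)) m∈B)
    }

  A≡liftˡ : A ≡ liftˡ m N Y
  A≡liftˡ = ⊑-extensional (upTo⁺ N) A⊑ liftˡ-⊑ A⊆ ⊆A
    where
    A⊆ : ∀ {a} → a ∈ A → a ∈ liftˡ m N Y
    A⊆ {a} a∈A = subst (_∈ liftˡ m N Y) (sym (quotRem m a))
      (∈-liftˡ⁺ {y = a / m} (subst (_< N) (quotRem m a) (A-bounded a∈A)) (∈Y⁺ (A-base a∈A)) (m%n<n a m))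
    ⊆A : ∀ {a} → a ∈ liftˡ m N Y → a ∈ A
    ⊆A a∈ with _ , y , r , y∈Y , r<m , refl ← ∈-liftˡ⁻ a∈ = A-fill {y} (∈Y⁻ y∈Y) r<m

  B≡liftʳ : B ≡ liftʳ m N X
  B≡liftʳ = ⊑-extensional (upTo⁺ N) B⊑ liftʳ-⊑ B⊆ ⊆B
    where
    B⊆ : ∀ {b} → b ∈ B → b ∈ liftʳ m N X
    B⊆ {b} b∈B = subst (_∈ liftʳ m N X) (sym (B-multiple b∈B))
      (∈-liftʳ⁺ {x = b / m} (subst (_< N) (B-multiple b∈B) (B-bounded b∈B)) (∈X⁺ (subst (_∈ B) (B-multiple b∈B) b∈B)))
    ⊆B : ∀ {b} → b ∈ liftʳ m N X → b ∈ B
    ⊆B b∈ with _ , x , x∈X , refl ← ∈-liftʳ⁻ b∈ = ∈X⁻ x∈X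

opaque
  tilings₂ : ℕ → List (List (List ℕ))
  tilings₂ N = filterᵇ (valid N) (tuples 2 (subsets (upTo N)))

opaque
  unfolding tilings₂

  𝒩₂≡length-tilings₂ : ∀ N → 𝒩 2 N ≡ length (tilings₂ N)
  𝒩₂≡length-tilings₂ N = refl

  tilings₂-unique : ∀ N → Unique (tilings₂ N)
  tilings₂-unique N = filter⁺ (T? ∘ valid N) (tuples-unique 2 (subsets-unique (upTo⁺ N)))

  ∈-tilings₂⁻ : ∀ {N P} → P ∈ tilings₂ N →
    ∃₂ λ A B → P ≡ A ∷ B ∷ [] × A ⊑ upTo N × B ⊑ upTo N × Tiling N A B × 1 < length A × 1 < length B
  ∈-tilings₂⁻ {N} P∈ with P∈tuples , valid-P ← ∈-filter⁻ (T? ∘ valid N) {xs = tuples 2 (subsets (upTo N))} P∈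
    with A , _ , refl , A∈ , rest∈ ← ∈-tuples⁻ {k = 1} {xs = subsets (upTo N)} P∈tuples
    with B , _ , refl , B∈ , here refl ← ∈-tuples⁻ {k = 0} {xs = subsets (upTo N)} rest∈
    with A⊑ ← ∈-subsets⁻ A∈ | B⊑ ← ∈-subsets⁻ B∈
    with tiling , 1<|A| , 1<|B| ← Equivalence.to (valid-pair⇔ A⊑ B⊑) valid-P =
    A , B , refl , A⊑ , B⊑ , tiling , 1<|A| , 1<|B|

  ∈-tilings₂⁺ : ∀ {N A B} → A ⊑ upTo N → B ⊑ upTo N → Tiling N A B → 1 < length A → 1 < length B →
                A ∷ B ∷ [] ∈ tilings₂ N
  ∈-tilings₂⁺ {N} A⊑ B⊑ tiling 1<|A| 1<|B| =
    ∈-filter⁺ (T? ∘ valid N) (∈-tuples⁺ {k = 1} (∈-subsets⁺ A⊑) (∈-tuples⁺ {k = 0} (∈-subsets⁺ B⊑) (here refl)))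
      (Equivalence.from (valid-pair⇔ A⊑ B⊑) (tiling , 1<|A| , 1<|B|))

first : List (List ℕ) → List ℕ
first [] = []  -- junk value; only pairs are ever inspected
first (A ∷ _) = A

opaque
  normalTilings : ℕ → List (List (List ℕ))
  normalTilings N = filter (λ P → 1 ∈? first P) (tilings₂ N)

opaque
  unfolding normalTilings

  normalTilings-unique : ∀ N → Unique (normalTilings N)
  normalTilings-unique N = filter⁺ (λ P → 1 ∈? first P) (tilings₂-unique N)

  ∈-normalTilings⁻ : ∀ {N P} → P ∈ normalTilings N → ∃₂ λ A B → P ≡ A ∷ B ∷ [] × NormalTiling N A B × 1 < length B
  ∈-normalTilings⁻ {N} P∈ with P∈tilings , 1∈A ← ∈-filter⁻ (λ P → 1 ∈? first P) {xs = tilings₂ N} P∈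
    with A , B , refl , A⊑ , B⊑ , tiling , _ , 1<|B| ← ∈-tilings₂⁻ P∈tilings =
    A , B , refl , record { A⊑ = A⊑ ; B⊑ = B⊑ ; tiling = tiling ; 1∈A = 1∈A } , 1<|B|

  ∈-normalTilings⁺ : ∀ {N A B} → NormalTiling N A B → 1 < length B → A ∷ B ∷ [] ∈ normalTilings N
  ∈-normalTilings⁺ {N} normal 1<|B| =
    ∈-filter⁺ (λ P → 1 ∈? first P) (∈-tilings₂⁺ A⊑ B⊑ tiling 1<|A| 1<|B|) 1∈A
    where open NormalTiling normal

  normalTilings⊆tilings₂ : ∀ {N P} → P ∈ normalTilings N → P ∈ tilings₂ N
  normalTilings⊆tilings₂ {N} P∈ = proj₁ (∈-filter⁻ (λ P → 1 ∈? first P) {xs = tilings₂ N} P∈)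

swap₂ : List (List ℕ) → List (List ℕ)
swap₂ (A ∷ B ∷ []) = B ∷ A ∷ []
swap₂ P = P  -- not a pair: junk value, never used

normal++swapped : ℕ → List (List (List ℕ))
normal++swapped N = normalTilings N ++ map swap₂ (normalTilings N)

normal++swapped-unique : ∀ N → Unique (normal++swapped N)
normal++swapped-unique N = ++⁺ (normalTilings-unique N) (map-unique swap₂ swap-injective (normalTilings-unique N)) disjoint
  where
  swap-injective : ∀ {P Q} → P ∈ normalTilings N → Q ∈ normalTilings N → swap₂ P ≡ swap₂ Q → P ≡ Q
  swap-injective P∈ Q∈ eq with _ , _ , refl , _ ← ∈-normalTilings⁻ P∈ | _ , _ , refl , _ ← ∈-normalTilings⁻ Q∈
    with refl , refl ← ∷-injective eq = refl
  disjoint : ∀ {P} → ¬ (P ∈ normalTilings N × P ∈ map swap₂ (normalTilings N))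
  disjoint (P∈ , P∈swapped) with Q , Q∈ , refl ← ∈-map⁻ swap₂ P∈swapped
    with _ , _ , refl , normal , _ ← ∈-normalTilings⁻ Q∈ | _ , _ , refl , normal′ , _ ← ∈-normalTilings⁻ P∈ =
    Tiling.1∉ˡ∩ʳ (NormalTiling.tiling normal) (NormalTiling.1∈A normal) (NormalTiling.1∈A normal′)

tilings₂⊆normal++swapped : ∀ {N P} → P ∈ tilings₂ N → P ∈ normal++swapped N
tilings₂⊆normal++swapped {N} P∈ with A , B , refl , A⊑ , B⊑ , tiling , 1<|A| , 1<|B| ← ∈-tilings₂⁻ P∈
  with Tiling.1∈ˡ⊎1∈ʳ tiling (≤-trans 1<|A| (subst (length A ≤_) (length-upTo N) (length-mono-≤ A⊑)))
... | inj₁ 1∈A = ∈-++⁺ˡ (∈-normalTilings⁺ (record { A⊑ = A⊑ ; B⊑ = B⊑ ; tiling = tiling ; 1∈A = 1∈A }) 1<|B|)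
... | inj₂ 1∈B = ∈-++⁺ʳ (normalTilings N)
  (∈-map⁺ swap₂ (∈-normalTilings⁺ (record { A⊑ = B⊑ ; B⊑ = A⊑ ; tiling = Tiling.swap tiling ; 1∈A = 1∈B }) 1<|A|))

normal++swapped⊆tilings₂ : ∀ {N P} → P ∈ normal++swapped N → P ∈ tilings₂ N
normal++swapped⊆tilings₂ {N} P∈ with ∈-++⁻ (normalTilings N) P∈
... | inj₁ P∈normal = normalTilings⊆tilings₂ P∈normal
... | inj₂ P∈swapped with Q , Q∈ , refl ← ∈-map⁻ swap₂ P∈swapped
  with A , B , refl , normal , 1<|B| ← ∈-normalTilings⁻ Q∈ =
  ∈-tilings₂⁺ B⊑ A⊑ (Tiling.swap tiling) 1<|B| 1<|A|
  where open NormalTiling normal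

𝒩₂≡2*normal : ∀ N → 𝒩 2 N ≡ 2 * length (normalTilings N)
𝒩₂≡2*normal N = begin
  𝒩 2 N                         ≡⟨ 𝒩₂≡length-tilings₂ N ⟩
  length (tilings₂ N)           ≡⟨ unique∧⊆⊇⇒length≡ (tilings₂-unique N) (normal++swapped-unique N)
                                     tilings₂⊆normal++swapped normal++swapped⊆tilings₂ ⟩
  length (normal++swapped N)    ≡⟨ length-++ (normalTilings N) ⟩
  |normal| + length (map swap₂ (normalTilings N)) ≡⟨ cong (|normal| +_) (length-map swap₂ (normalTilings N)) ⟩
  |normal| + |normal|           ≡⟨ cong (|normal| +_) (+-identityʳ |normal|) ⟨
  2 * |normal|                  ∎
  where
  open ≡-Reasoning
  |normal| : ℕ
  |normal| = length (normalTilings N)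

-- Counting normal tilings by divisors

opaque
  nontrivialDivisors : ℕ → List ℕ
  nontrivialDivisors N = filter (2 ≤?_) (properDivisors N)

module _ {N d : ℕ} where
  opaque
    unfolding nontrivialDivisors

    ∈-nontrivialDivisors⁻ : d ∈ nontrivialDivisors N → 2 ≤ d × d < N × d ∣ N
    ∈-nontrivialDivisors⁻ d∈ with d∈proper , 2≤d ← ∈-filter⁻ (2 ≤?_) {xs = properDivisors N} d∈
                             with d∈upTo , d∣N ← ∈-filter⁻ (_∣? N) {xs = upTo N} d∈proper =
      2≤d , ∈-upTo⁻ d∈upTo , d∣N

    ∈-nontrivialDivisors⁺ : 2 ≤ d → d < N → d ∣ N → d ∈ nontrivialDivisors N
    ∈-nontrivialDivisors⁺ 2≤d d<N d∣N = ∈-filter⁺ (2 ≤?_) (∈-filter⁺ (_∣? N) (∈-upTo⁺ d<N) d∣N) 2≤d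

opaque
  unfolding nontrivialDivisors

  nontrivialDivisors-unique : ∀ N → Unique (nontrivialDivisors N)
  nontrivialDivisors-unique N = filter⁺ (2 ≤?_) (filter⁺ (_∣? N) (upTo⁺ N))

cofactor : ℕ → ℕ → ℕ
cofactor N zero = 0  -- junk value; only divisors d ≥ 2 occur
cofactor N (suc d) = N / suc d

cofactor-* : ∀ {d} m → 0 < d → cofactor (d * m) d ≡ m
cofactor-* {suc d} m _ = trans (cong (_/ suc d) (*-comm (suc d) m)) (m*n/n≡m m (suc d))

∈-nontrivialDivisors⇒cofactor : ∀ {N d} → d ∈ nontrivialDivisors N → 1 < cofactor N d × N ≡ d * cofactor N d
∈-nontrivialDivisors⇒cofactor {d = zero} d∈ with () ← proj₁ (∈-nontrivialDivisors⁻ d∈)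
∈-nontrivialDivisors⇒cofactor {N} {d@(suc _)} d∈ with 2≤d , d<N , d∣N ← ∈-nontrivialDivisors⁻ d∈ = 1<c , N≡d*c
  where
  N≡d*c : N ≡ d * cofactor N d
  N≡d*c = trans (sym (m/n*n≡m d∣N)) (*-comm (N / d) d)
  1<c : 1 < cofactor N d
  1<c = *-cancelˡ-< d 1 (cofactor N d) (subst₂ _<_ (sym (*-identityʳ d)) N≡d*c d<N)

trivialTiling : ℕ → List (List ℕ)
trivialTiling d = upTo d ∷ [ 0 ] ∷ []

[0]⊑upTo : ∀ {d} → 0 < d → [ 0 ] ⊑ upTo d
[0]⊑upTo {suc _} _ = refl ∷ Sublist.minimum _

trivialTiling-normal : ∀ {d} → 1 < d → NormalTiling d (upTo d) [ 0 ]
trivialTiling-normal {d} 1<d = record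
  { A⊑ = ⊆-refl
  ; B⊑ = [0]⊑upTo (<-trans z<s 1<d)
  ; tiling = record
    { sum-< = λ { {a} a∈ (here refl) → subst (_< d) (sym (+-identityʳ a)) (∈-upTo⁻ a∈) }
    ; sum-onto = λ {t} t<d → t , 0 , ∈-upTo⁺ t<d , here refl , +-identityʳ t
    ; sum-unique = λ { {a} {_} {a′} _ (here refl) _ (here refl) eq → +-cancelʳ-≡ 0 a a′ eq }
    }
  ; 1∈A = ∈-upTo⁺ 1<d
  }

thin⇒trivial : ∀ {d X Y} → NormalTiling d X Y → ¬ 1 < length Y → X ∷ Y ∷ [] ≡ trivialTiling d
thin⇒trivial {d} {X} {Y} normal ¬1<|Y| = cong₂ (λ X Y → X ∷ Y ∷ []) X≡upTo Y≡[0]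
  where
  open NormalTiling normal renaming (A⊑ to X⊑; B⊑ to Y⊑)
  open Tiling tiling
  0<d : 0 < d
  0<d = <-trans z<s 1<N

  0∈Y : 0 ∈ Y
  0∈Y = 0∈ʳ 0<d

  only-0 : ∀ {y} → y ∈ Y → y ≡ 0
  only-0 {y} y∈Y with y ≟ 0
  ... | yes y≡0 = y≡0
  ... | no y≢0 = contradiction (distinct-∈⇒1<length y∈Y 0∈Y y≢0) ¬1<|Y|

  Y≡[0] : Y ≡ [ 0 ]
  Y≡[0] = ⊑-extensional (upTo⁺ d) Y⊑ ([0]⊑upTo 0<d) (here ∘ only-0) λ { (here refl) → 0∈Y }

  X≡upTo : X ≡ upTo d
  X≡upTo = ⊑-extensional (upTo⁺ d) X⊑ ⊆-refl (Sublist.lookup X⊑) covered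
    where
    covered : ∀ {t} → t ∈ upTo d → t ∈ X
    covered t∈ with x , y , x∈X , y∈Y , x+y≡t ← sum-onto (∈-upTo⁻ t∈) =
      subst (_∈ X) (trans (sym (+-identityʳ x)) (trans (cong (x +_) (sym (only-0 y∈Y))) x+y≡t)) x∈X

-- The trivial quotient ([0, d), {0}) accounts for the term 𝒩₁(d) = 1 of the recurrence.
liftsFrom : ℕ → ℕ → List (List (List ℕ))
liftsFrom N d = map (lift (cofactor N d) N) (trivialTiling d ∷ normalTilings d)

quotient-normal : ∀ {d Q} → 1 < d → Q ∈ trivialTiling d ∷ normalTilings d →
                  ∃₂ λ X Y → Q ≡ X ∷ Y ∷ [] × NormalTiling d X Y
quotient-normal 1<d (here refl) = _ , _ , refl , trivialTiling-normal 1<d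
quotient-normal 1<d (there Q∈) with X , Y , refl , normal , _ ← ∈-normalTilings⁻ Q∈ = X , Y , refl , normal

liftsFrom⊆normalTilings : ∀ {N d P} → d ∈ nontrivialDivisors N → P ∈ liftsFrom N d → P ∈ normalTilings N
liftsFrom⊆normalTilings d∈ P∈ with 1<c , N≡d*c ← ∈-nontrivialDivisors⇒cofactor d∈
  with Q , Q∈ , refl ← ∈-map⁻ _ P∈
  with X , Y , refl , normal ← quotient-normal (proj₁ (∈-nontrivialDivisors⁻ d∈)) Q∈ =
  ∈-normalTilings⁺ (Lifting.lifted 1<c N≡d*c normal) (Lifting.1<|B↑| 1<c N≡d*c normal)

normalTilings⊆liftsFrom : ∀ {N P} → P ∈ normalTilings N → ∃ λ d → d ∈ nontrivialDivisors N × P ∈ liftsFrom N d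
normalTilings⊆liftsFrom {N} P∈ with A , B , refl , normal , 1<|B| ← ∈-normalTilings⁻ P∈
  with m , m∈B , 0<m , m-least ← least-positive (NormalTiling.B⊑ normal) 1<|B| = d , d∈ , P∈lifts
  where
  open Descent normal m∈B 0<m m-least
  0<d : 0 < d
  0<d = <-trans z<s (NormalTiling.1<N quotient)
  d∈ : d ∈ nontrivialDivisors N
  d∈ = ∈-nontrivialDivisors⁺ (NormalTiling.1<N quotient)
         (subst (d <_) (sym N≡d*m) (subst (_< d * m) (*-identityʳ d) (*-monoʳ-< d {{>-nonZero 0<d}} 1<m)))
         (divides m (trans N≡d*m (*-comm d m)))
  cofactor≡m : cofactor N d ≡ m
  cofactor≡m = trans (cong (λ n → cofactor n d) N≡d*m) (cofactor-* m 0<d)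
  Q∈ : X ∷ Y ∷ [] ∈ trivialTiling d ∷ normalTilings d
  Q∈ with 1 <? length Y
  ... | yes 1<|Y| = there (∈-normalTilings⁺ quotient 1<|Y|)
  ... | no ¬1<|Y| = here (thin⇒trivial quotient ¬1<|Y|)
  P∈lifts : A ∷ B ∷ [] ∈ liftsFrom N d
  P∈lifts = subst (λ P → P ∈ liftsFrom N d) (cong₂ (λ A B → A ∷ B ∷ []) (sym A≡liftˡ) (sym B≡liftʳ))
              (subst (λ c → lift c N (X ∷ Y ∷ []) ∈ liftsFrom N d) cofactor≡m (∈-map⁺ (lift (cofactor N d) N) Q∈))

liftsFrom-unique : ∀ {N d} → d ∈ nontrivialDivisors N → Unique (liftsFrom N d)
liftsFrom-unique {N} {d} d∈ = map-unique (lift c N) lift-injective (trivial∉ ∷ normalTilings-unique d)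
  where
  c : ℕ
  c = cofactor N d

  2≤d : 2 ≤ d
  2≤d = proj₁ (∈-nontrivialDivisors⁻ d∈)

  N≡d*c : N ≡ d * c
  N≡d*c = proj₂ (∈-nontrivialDivisors⇒cofactor d∈)

  instance
    c-nonZero : NonZero c
    c-nonZero = >-nonZero (<-trans z<s (proj₁ (∈-nontrivialDivisors⇒cofactor d∈)))

  trivial∉ : All (trivialTiling d ≢_) (normalTilings d)
  trivial∉ = All.tabulate λ Q∈ trivial≡Q → case Q∈ trivial≡Q
    where
    case : ∀ {Q} → Q ∈ normalTilings d → trivialTiling d ≢ Q
    case Q∈ refl with _ , _ , refl , _ , s≤s () ← ∈-normalTilings⁻ Q∈

  lift-injective : ∀ {Q Q′} → Q ∈ trivialTiling d ∷ normalTilings d → Q′ ∈ trivialTiling d ∷ normalTilings d →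
                   lift c N Q ≡ lift c N Q′ → Q ≡ Q′
  lift-injective Q∈ Q′∈ eq
    with _ , _ , refl , normal ← quotient-normal 2≤d Q∈ | _ , _ , refl , normal′ ← quotient-normal 2≤d Q′∈
    with eqˡ , eqʳ∷[] ← ∷-injective eq =
    cong₂ (λ X Y → X ∷ Y ∷ [])
      (liftʳ-injective N≡d*c (NormalTiling.A⊑ normal) (NormalTiling.A⊑ normal′) (∷-injectiveˡ eqʳ∷[]))
      (liftˡ-injective N≡d*c (NormalTiling.B⊑ normal) (NormalTiling.B⊑ normal′) eqˡ)

liftsFrom-disjoint : ∀ {N d d′ P} → d ∈ nontrivialDivisors N → d′ ∈ nontrivialDivisors N →
                     P ∈ liftsFrom N d → P ∈ liftsFrom N d′ → d ≡ d′
liftsFrom-disjoint {N} {d} {d′} d∈ d′∈ P∈ P∈′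
  with 1<c , N≡d*c ← ∈-nontrivialDivisors⇒cofactor d∈ | 1<c′ , N≡d′*c′ ← ∈-nontrivialDivisors⇒cofactor d′∈
  with Q , Q∈ , refl ← ∈-map⁻ _ P∈ | Q′ , Q′∈ , eq ← ∈-map⁻ _ P∈′
  with X , _ , refl , normal ← quotient-normal (proj₁ (∈-nontrivialDivisors⁻ d∈)) Q∈
     | X′ , _ , refl , normal′ ← quotient-normal (proj₁ (∈-nontrivialDivisors⁻ d′∈)) Q′∈ =
  *-cancelʳ-≡ d d′ (cofactor N d) {{>-nonZero (<-trans z<s 1<c)}} (trans (sym N≡d*c) (trans N≡d′*c′ (cong (d′ *_) (sym c≡c′))))
  where
  Bs-equal : liftʳ (cofactor N d) N X ≡ liftʳ (cofactor N d′) N X′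
  Bs-equal = ∷-injectiveˡ (∷-injectiveʳ eq)
  c≡c′ : cofactor N d ≡ cofactor N d′
  c≡c′ = ∣-antisym
    (liftʳ-multiple (subst (_ ∈_) (sym Bs-equal) (Lifting.m∈B↑ 1<c′ N≡d′*c′ normal′)))
    (liftʳ-multiple (subst (_ ∈_) Bs-equal (Lifting.m∈B↑ 1<c N≡d*c normal)))

normalTilings-count : ∀ N → length (normalTilings N) ≡ sum (map (λ d → suc (length (normalTilings d))) (nontrivialDivisors N))
normalTilings-count N = begin
  length (normalTilings N)                              ≡⟨ unique∧⊆⊇⇒length≡ (normalTilings-unique N) lifts-unique ⊆lifts lifts⊆ ⟩
  length (concatMap (liftsFrom N) divisors)             ≡⟨ length-concatMap (liftsFrom N) divisors ⟩
  sum (map (length ∘ liftsFrom N) divisors)             ≡⟨ cong sum (map-cong length-liftsFrom divisors) ⟩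
  sum (map (λ d → suc (length (normalTilings d))) divisors) ∎
  where
  open ≡-Reasoning
  divisors : List ℕ
  divisors = nontrivialDivisors N

  length-liftsFrom : ∀ d → length (liftsFrom N d) ≡ suc (length (normalTilings d))
  length-liftsFrom d = length-map (lift (cofactor N d) N) (trivialTiling d ∷ normalTilings d)

  lifts-unique : Unique (concatMap (liftsFrom N) divisors)
  lifts-unique = concatMap-unique (liftsFrom N) (nontrivialDivisors-unique N) liftsFrom-unique liftsFrom-disjoint

  ⊆lifts : ∀ {P} → P ∈ normalTilings N → P ∈ concatMap (liftsFrom N) divisors
  ⊆lifts P∈ with d , d∈ , P∈lifts ← normalTilings⊆liftsFrom P∈ =
    ∈-concatMap⁺ (liftsFrom N) (Any.map (λ { refl → P∈lifts }) d∈)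

  lifts⊆ : ∀ {P} → P ∈ concatMap (liftsFrom N) divisors → P ∈ normalTilings N
  lifts⊆ P∈ with d , d∈ , P∈lifts ← find (∈-concatMap⁻ (liftsFrom N) {xs = divisors} P∈) =
    liftsFrom⊆normalTilings d∈ P∈lifts

sum-map-+ : ∀ (f g : A → ℕ) xs → sum (map (λ x → f x + g x) xs) ≡ sum (map f xs) + sum (map g xs)
sum-map-+ f g [] = refl
sum-map-+ f g (x ∷ xs) = trans (cong (f x + g x +_) (sum-map-+ f g xs)) (interchange (f x) (g x) _ _)

*-distribˡ-sum : ∀ k (g : A → ℕ) xs → k * sum (map g xs) ≡ sum (map (λ x → k * g x) xs)
*-distribˡ-sum k g [] = *-zeroʳ k
*-distribˡ-sum k g (x ∷ xs) = trans (*-distribˡ-+ k (g x) _) (cong (k * g x +_) (*-distribˡ-sum k g xs))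

sum-map-const : ∀ c (xs : List A) → sum (map (λ _ → c) xs) ≡ length xs * c
sum-map-const c [] = refl
sum-map-const c (x ∷ xs) = cong (c +_) (sum-map-const c xs)

half : ℕ → ℚ
half n = ℤ+ n /ℚ 2

half-+ : ∀ a b → half (a + b) ≡ half a +ℚ half b
half-+ a b = sym (toℚᵘ-injective (≃-trans (toℚᵘ-homo-+ (half a) (half b))
  (≃-trans (+-cong (toℚᵘ-fromℚᵘ (mkℚᵘ (ℤ+ a) 1)) (toℚᵘ-fromℚᵘ (mkℚᵘ (ℤ+ b) 1)))
  (≃-trans (*≡* cross-multiplied) (≃-sym (toℚᵘ-fromℚᵘ (mkℚᵘ (ℤ+ (a + b)) 1)))))))
  where
  cross-multiplied : ((ℤ+ a) *ℤ (ℤ+ 2) +ℤ (ℤ+ b) *ℤ (ℤ+ 2)) *ℤ (ℤ+ 2) ≡ (ℤ+ (a + b)) *ℤ (ℤ+ 4)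
  cross-multiplied = trans (lemma (ℤ+ a) (ℤ+ b)) (cong (_*ℤ (ℤ+ 4)) (sym (pos-+ a b)))
    where
    lemma : ∀ x y → (x *ℤ (ℤ+ 2) +ℤ y *ℤ (ℤ+ 2)) *ℤ (ℤ+ 2) ≡ (x +ℤ y) *ℤ (ℤ+ 4)
    lemma = solveℤ-∀

half-2* : ∀ n → half (2 * n) ≡ ℤ+ n /ℚ 1
half-2* n = sym (toℚᵘ-injective (≃-trans (toℚᵘ-fromℚᵘ (mkℚᵘ (ℤ+ n) 0))
  (≃-trans (*≡* cross-multiplied) (≃-sym (toℚᵘ-fromℚᵘ (mkℚᵘ (ℤ+ (2 * n)) 1))))))
  where
  cross-multiplied : (ℤ+ n) *ℤ (ℤ+ 2) ≡ (ℤ+ (2 * n)) *ℤ (ℤ+ 1)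
  cross-multiplied = trans (lemma (ℤ+ n)) (cong (_*ℤ (ℤ+ 1)) (sym (trans (cong (λ k → ℤ+ (n + k)) (+-identityʳ n)) (pos-+ n n))))
    where
    lemma : ∀ x → x *ℤ (ℤ+ 2) ≡ (x +ℤ x) *ℤ (ℤ+ 1)
    lemma = solveℤ-∀

sumℚ-map-half : ∀ (g : ℕ → ℕ) xs → sumℚ (map (half ∘ g) xs) ≡ half (sum (map g xs))
sumℚ-map-half g [] = sym (0/n≡0 2)
sumℚ-map-half g (x ∷ xs) = trans (cong (half (g x) +ℚ_) (sumℚ-map-half g xs)) (sym (half-+ (g x) (sum (map g xs))))

-- The recurrences

𝒩₁≡1 : ∀ {d} → 2 ≤ d → 𝒩 1 d ≡ 1
𝒩₁≡1 {d} 2≤d =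
  unique∧⊆⊇⇒length≡ (filter⁺ (T? ∘ valid d) (tuples-unique 1 (subsets-unique (upTo⁺ d)))) ([] ∷ []) only whole
  where
  only : ∀ {P} → P ∈ filterᵇ (valid d) (tuples 1 (subsets (upTo d))) → P ∈ [ [ upTo d ] ]
  only P∈ with P∈tuples , valid-P ← ∈-filter⁻ (T? ∘ valid d) {xs = tuples 1 (subsets (upTo d))} P∈
    with A , _ , refl , A∈ , here refl ← ∈-tuples⁻ {k = 0} {xs = subsets (upTo d)} P∈tuples =
    here (cong [_] (Equivalence.to (valid-singleton⇔ 2≤d (∈-subsets⁻ A∈)) valid-P))
  whole : ∀ {P} → P ∈ [ [ upTo d ] ] → P ∈ filterᵇ (valid d) (tuples 1 (subsets (upTo d)))
  whole (here refl) = ∈-filter⁺ (T? ∘ valid d) (∈-tuples⁺ {k = 0} (∈-subsets⁺ ⊆-refl) (here refl))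
    (Equivalence.from (valid-singleton⇔ 2≤d ⊆-refl) refl)

module _ (n : ℕ) where

  private
    N : ℕ
    N = suc (suc n)

    above-1 : List ℕ
    above-1 = applyUpTo (suc ∘ suc) n

  opaque
    unfolding nontrivialDivisors

    properDivisors≡1∷nontrivial : properDivisors N ≡ 1 ∷ nontrivialDivisors N
    properDivisors≡1∷nontrivial = trans proper≡ (cong (1 ∷_) (sym nontrivial≡))
      where
      proper≡ : properDivisors N ≡ 1 ∷ filter (_∣? N) above-1
      proper≡ = trans (filter-reject (_∣? N) {0} {1 ∷ above-1} (λ 0∣N → 1+n≢0 (0∣⇒≡0 0∣N)))
                      (filter-accept (_∣? N) {1} {above-1} (1∣ N))
      ≥2 : All (2 ≤_) (filter (_∣? N) above-1)
      ≥2 = All.tabulate (2≤ ∘ proj₁ ∘ ∈-filter⁻ (_∣? N) {xs = above-1})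
        where
        2≤ : ∀ {d} → d ∈ above-1 → 2 ≤ d
        2≤ d∈ with _ , _ , refl ← ∈-applyUpTo⁻ (suc ∘ suc) d∈ = s≤s (s≤s z≤n)
      nontrivial≡ : nontrivialDivisors N ≡ filter (_∣? N) above-1
      nontrivial≡ = trans (cong (filter (2 ≤?_)) proper≡)
        (trans (filter-reject (2 ≤?_) {1} {filter (_∣? N) above-1} (λ { (s≤s ()) })) (filter-all (2 ≤?_) ≥2))

d₂≡suc-length : ∀ N → d₂ N ≡ suc (length (properDivisors N))
d₂≡suc-length N = begin
  length (filter (_∣? N) (upTo (suc N)))              ≡⟨ cong (length ∘ filter (_∣? N)) (upTo-∷ʳ N) ⟨
  length (filter (_∣? N) (upTo N ++ [ N ]))           ≡⟨ cong length (filter-++ (_∣? N) (upTo N) [ N ]) ⟩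
  length (properDivisors N ++ filter (_∣? N) [ N ])   ≡⟨ cong (length ∘ (properDivisors N ++_)) (filter-accept (_∣? N) {xs = []} ∣-refl) ⟩
  length (properDivisors N ++ [ N ])                  ≡⟨ length-++ (properDivisors N) ⟩
  length (properDivisors N) + 1                       ≡⟨ +-comm _ 1 ⟩
  suc (length (properDivisors N))                     ∎
  where open ≡-Reasoning

module _ (n : ℕ) where

  private
    N : ℕ
    N = suc (suc n)

    divisors : List ℕ
    divisors = nontrivialDivisors N

    term : ℕ → ℕ
    term d = 𝒩 2 d + 2 * 𝒩 1 d

  sum-properDivisors : ∀ (g : ℕ → ℕ) → g 1 ≡ 0 → sum (map g (properDivisors N)) ≡ sum (map g divisors)
  sum-properDivisors g g1≡0 = trans (cong (sum ∘ map g) (properDivisors≡1∷nontrivial n)) (cong (_+ sum (map g divisors)) g1≡0)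

  sum-term≡ : sum (map term divisors) ≡ sum (map (λ d → 𝒩 2 d + 2) divisors)
  sum-term≡ = cong sum (map-cong-local (All.tabulate λ {d} d∈ →
    cong (λ k → 𝒩 2 d + 2 * k) (𝒩₁≡1 (proj₁ (∈-nontrivialDivisors⁻ d∈)))))

  𝒩₂-recurrence : 𝒩 2 N ≡ sum (map term (properDivisors N))
  𝒩₂-recurrence = begin
    𝒩 2 N                                                       ≡⟨ 𝒩₂≡2*normal N ⟩
    2 * length (normalTilings N)                                ≡⟨ cong (2 *_) (normalTilings-count N) ⟩
    2 * sum (map (λ d → suc (length (normalTilings d))) divisors) ≡⟨ *-distribˡ-sum 2 _ divisors ⟩
    sum (map (λ d → 2 * suc (length (normalTilings d))) divisors) ≡⟨ cong sum (map-cong twice-suc divisors) ⟩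
    sum (map (λ d → 𝒩 2 d + 2) divisors)                        ≡⟨ sum-term≡ ⟨
    sum (map term divisors)                                     ≡⟨ sum-properDivisors term refl ⟨
    sum (map term (properDivisors N))                           ∎
    where
    open ≡-Reasoning
    twice-suc : ∀ d → 2 * suc (length (normalTilings d)) ≡ 𝒩 2 d + 2
    twice-suc d = trans (*-suc 2 _) (trans (+-comm 2 _) (cong (_+ 2) (sym (𝒩₂≡2*normal d))))

  𝒩₂-divisor-sum : sum (map term (properDivisors N)) ≡ (2 * d₂ N ∸ 4) + sum (map (𝒩 2) (properDivisors N))
  𝒩₂-divisor-sum = begin
    sum (map term (properDivisors N))                       ≡⟨ sum-properDivisors term refl ⟩
    sum (map term divisors)                                 ≡⟨ sum-term≡ ⟩
    sum (map (λ d → 𝒩 2 d + 2) divisors)                    ≡⟨ sum-map-+ (𝒩 2) (λ _ → 2) divisors ⟩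
    sum (map (𝒩 2) divisors) + sum (map (λ _ → 2) divisors) ≡⟨ cong (sum (map (𝒩 2) divisors) +_) (sum-map-const 2 divisors) ⟩
    sum (map (𝒩 2) divisors) + length divisors * 2          ≡⟨ +-comm _ (length divisors * 2) ⟩
    length divisors * 2 + sum (map (𝒩 2) divisors)          ≡⟨ cong₂ _+_ 2d₂-4≡ (sum-properDivisors (𝒩 2) refl) ⟨
    (2 * d₂ N ∸ 4) + sum (map (𝒩 2) (properDivisors N))     ∎
    where
    open ≡-Reasoning
    d₂≡2+|divisors| : d₂ N ≡ 2 + length divisors
    d₂≡2+|divisors| = trans (d₂≡suc-length N) (cong (suc ∘ length) (properDivisors≡1∷nontrivial n))
    2d₂-4≡ : 2 * d₂ N ∸ 4 ≡ length divisors * 2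
    2d₂-4≡ = cong (_∸ 4) (trans (cong (2 *_) d₂≡2+|divisors|) (*-comm 2 (2 + length divisors)))

  ℳ-term : ∀ d → ℳ 2 d +ℚ ℳ 1 d ≡ half (term d)
  ℳ-term d = trans (cong (half (𝒩 2 d) +ℚ_) (sym (half-2* (𝒩 1 d)))) (sym (half-+ (𝒩 2 d) (2 * 𝒩 1 d)))

  sumℚ-ℳ-terms : sumℚ (map (λ d → ℳ 2 d +ℚ ℳ 1 d) (properDivisors N)) ≡ half (sum (map term (properDivisors N)))
  sumℚ-ℳ-terms = trans (cong sumℚ (map-cong ℳ-term (properDivisors N))) (sumℚ-map-half term (properDivisors N))

  ℳ₂-recurrence : ℳ 2 N ≡ sumℚ (map (λ d → ℳ 2 d +ℚ ℳ 1 d) (properDivisors N))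
  ℳ₂-recurrence = trans (cong half 𝒩₂-recurrence) (sym sumℚ-ℳ-terms)

  ℳ₂-divisor-sum : sumℚ (map (λ d → ℳ 2 d +ℚ ℳ 1 d) (properDivisors N))
                   ≡ (ℤ+ (c₂ N) /ℚ 1) +ℚ sumℚ (map (ℳ 2) (properDivisors N))
  ℳ₂-divisor-sum = begin
    sumℚ (map (λ d → ℳ 2 d +ℚ ℳ 1 d) (properDivisors N))            ≡⟨ sumℚ-ℳ-terms ⟩
    half (sum (map term (properDivisors N)))                       ≡⟨ cong half 𝒩₂-divisor-sum ⟩
    half ((2 * d₂ N ∸ 4) + sum (map (𝒩 2) (properDivisors N)))     ≡⟨ half-+ (2 * d₂ N ∸ 4) (sum (map (𝒩 2) (properDivisors N))) ⟩
    half (2 * d₂ N ∸ 4) +ℚ half (sum (map (𝒩 2) (properDivisors N))) ≡⟨ cong₂ _+ℚ_ half[2d₂-4]≡c₂ (sym (sumℚ-map-half (𝒩 2) (properDivisors N))) ⟩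
    (ℤ+ (c₂ N) /ℚ 1) +ℚ sumℚ (map (ℳ 2) (properDivisors N))            ∎
    where
    open ≡-Reasoning
    half[2d₂-4]≡c₂ : half (2 * d₂ N ∸ 4) ≡ ℤ+ (c₂ N) /ℚ 1
    half[2d₂-4]≡c₂ = trans (cong half (sym (*-distribˡ-∸ 2 (d₂ N) 2))) (half-2* (c₂ N))

corollary4p3 : (N : ℕ) → 2 ≤ N →
    (𝒩 2 N ≡ sumℕ (map (λ d → 𝒩 2 d + 2 * 𝒩 1 d) (properDivisors N)))
    × (sumℕ (map (λ d → 𝒩 2 d + 2 * 𝒩 1 d) (properDivisors N))
        ≡ (2 * d₂ N ∸ 4) + sumℕ (map (𝒩 2) (properDivisors N)))
    × (ℳ 2 N ≡ sumℚ (map (λ d → ℳ 2 d +ℚ ℳ 1 d) (properDivisors N)))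
    × (sumℚ (map (λ d → ℳ 2 d +ℚ ℳ 1 d) (properDivisors N))
        ≡ Data.Rational._/_ (ℤ+ (c₂ N)) 1 +ℚ sumℚ (map (ℳ 2) (properDivisors N)))
corollary4p3 (suc (suc n)) (s≤s (s≤s z≤n)) = 𝒩₂-recurrence n , 𝒩₂-divisor-sum n , ℳ₂-recurrence n , ℳ₂-divisor-sum n
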